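{- Let $G=(V,E)$ be a multigraph without self-loops, equipped with utility and cost functions $\mathbf{u},\mathbf{c}$ over a finite label set $\Sigma$, and with a $1/(2K)$-integral fractional label assignment $\lambda$ for an integer $K\ge1$. Let $\delta\in[0,1]$ and $\eta\ge1$. Run the following procedure (Basic Rounding Step) with these parameters: (i) set $w_e:=\mathbf{u}(e,\lambda)+\eta\,\mathbf{c}(e,\lambda)$ for each $e\in E$; (ii) compute any weighted average $\delta/6$-relative defective $p$-coloring $\varphi$ of $G$ w.r.t. weights $w_e$ (for some $p$); (iii) let $E_b$ be the set of edges whose two endpoints get different colors; (iv) for $\gamma=1,\dots,p$ in sequence, for all nodes $v$ with $\varphi(v)=\gamma$ in parallel, with $\lambda$ denoting the current fractional assignment: let $\Sigma_v$ be the set of labels $\alpha$ with $\lambda_\alpha(v)=\frac{2i+1}{2K}$ for some integer $i\ge0$; for each $\alpha\in\Sigma_v$ let $\lambda^{(v,\alpha)}$ equal $\lambda$ except that $\lambda^{(v,\alpha)}_\alpha(v)=1$ and $\lambda^{(v,\alpha)}_\beta(v)=0$ for $\beta\ne\alpha$, let $\phi_{v,\alpha}:=\mathbf{u}(E_b(v),\lambda^{(v,\alpha)})-\eta\,\mathbf{c}(E_b(v),\lambda^{(v,\alpha)})$ and $\theta_{v,\alpha}:=\mathbf{u}(E_b(v),\lambda^{(v,\alpha)})+\eta\,\mathbf{c}(E_b(v),\lambda^{(v,\alpha)})$, and let $\hat\phi_{v,\alpha}$ be any value with $\phi_{v,\alpha}\ge\hat\phi_{v,\alpha}\ge\phi_{v,\alpha}-\frac{\delta}{6}\theta_{v,\alpha}$;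 partition $\Sigma_v$ into $\Sigma_v^+,\Sigma_v^-$ with $|\Sigma_v^+|=|\Sigma_v^-|$ and $\hat\phi_{v,\alpha}\ge\hat\phi_{v,\beta}$ for all $(\alpha,\beta)\in\Sigma_v^+\times\Sigma_v^-$; then set $\lambda_\alpha(v):=\lambda_\alpha(v)+\frac{1}{2K}$ for $\alpha\in\Sigma_v^+$ and $\lambda_\alpha(v):=\lambda_\alpha(v)-\frac{1}{2K}$ for $\alpha\in\Sigma_v^-$. Let $\lambda'$ be the fractional label assignment at the end. Then $\lambda'$ is a $1/K$-integral fractional label assignment and \[\mathbf{u}(\lambda')-\eta\,\mathbf{c}(\lambda')\ \ge\ \mathbf{u}(\lambda)-\eta\,\mathbf{c}(\lambda)-\delta\big(\mathbf{u}(\lambda)+\eta\,\mathbf{c}(\lambda)\big).\]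
   Context: For a multigraph $G=(V,E)$, $V(e)$ denotes the two endpoints of edge $e$, $E(v)$ the set of edges incident to $v$, and $F(v):=F\cap E(v)$ for $F\subseteq E$. A label assignment is $\ell:V\to\Sigma$. A fractional label assignment $\lambda$ assigns to each $v$ values $\lambda_\alpha(v)\in[0,1]$, $\alpha\in\Sigma$, with $\sum_\alpha\lambda_\alpha(v)=1$; it is $1/K$-integral if every $\lambda_\alpha(v)$ is an integer multiple of $1/K$. Utility and cost functions assign to each edge $e$ and each label assignment $\ell$ non-negative values $\mathbf{u}(e,\ell),\mathbf{c}(e,\ell)$ depending only on the labels of the endpoints of $e$. For fractional $\lambda$ and $V(e)=\{u,v\}$, $\mathbf{u}(e,\lambda):=\sum_{(\alpha,\beta)\in\Sigma^2}\lambda_\alpha(u)\lambda_\beta(v)\,\mathbf{u}(e,\ell_{\alpha,\beta})$ where $\ell_{\alpha,\beta}$ gives $u$ label $\alpha$ and $v$ label $\beta$ (similarly for $\mathbf{c}$). For $F\subseteq E$, $\mathbf{u}(F,\lambda)=\sum_{e\in F}\mathbf{u}(e,\lambda)$, $\mathbf{u}(\lambda)=\mathbf{u}(E,\lambda)$, and likewise for $\mathbf{c}$. A weighted average $\varepsilon$-relative defective $C$-coloring w.r.t. non-negative edge weights $w$ is $\varphi:V\to[C]$ with $\sum_{v\in V}\sum_{e\in E(v),V(e)=\{v,u\},\varphi(u)=\varphi(v)}w(e)\le\varepsilon\sum_{v\in V}\sum_{e\in E(v)}w(e)$. -}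

module Defs where

open import Level using (Level; _⊔_) renaming (suc to lsuc)
open import Data.Nat as ℕ using (ℕ; zero; suc; _%_; _∸_)
open import Data.Bool using (Bool; true; false; if_then_else_; _∧_; not)
open import Data.Fin using (Fin; zero; suc; _≟_)
open import Data.Product using (Σ; ∃; _×_; _,_; proj₁; proj₂)
open import Data.Sum using (_⊎_)
open import Data.List using (List; []; _∷_)
open import Relation.Nullary using (¬_; does)
open import Relation.Binary using (Rel; IsTotalOrder)
open import Relation.Binary.PropositionalEquality using (_≡_; _≢_)
open import Algebra.Bundles using (CommutativeRing)

-- Ordered fields (the paper works over ℝ; we state the result for an
-- arbitrary ordered field, ℝ being an instance).

record OrderedField (c ℓ₁ ℓ₂ : Level) : Set (lsuc (c ⊔ ℓ₁ ⊔ ℓ₂)) where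
  field
    commutativeRing : CommutativeRing c ℓ₁
  open CommutativeRing commutativeRing public
  infix 4 _≤_
  field
    _≤_          : Rel Carrier ℓ₂
    isTotalOrder : IsTotalOrder _≈_ _≤_
    +-mono-≤     : ∀ {x y} z → x ≤ y → (x + z) ≤ (y + z)
    *-nonneg     : ∀ {x y} → 0# ≤ x → 0# ≤ y → 0# ≤ (x * y)
    0≉1          : ¬ (0# ≈ 1#)
    inverse      : ∀ x → ¬ (x ≈ 0#) → ∃ λ y → (x * y) ≈ 1#

  fromℕ : ℕ → Carrier
  fromℕ zero    = 0#
  fromℕ (suc k) = 1# + fromℕ k

sumℕ : ∀ {k} → (Fin k → ℕ) → ℕ
sumℕ {zero}  f = 0
sumℕ {suc k} f = f zero ℕ.+ sumℕ (λ i → f (suc i))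

count : ∀ {k} → (Fin k → Bool) → ℕ
count f = sumℕ (λ i → if f i then 1 else 0)

isOdd : ℕ → Bool
isOdd k = does (k % 2 ℕ.≟ 1)

Even : ℕ → Set
Even k = k % 2 ≡ 0

module Rounding {c ℓ₁ ℓ₂} (F : OrderedField c ℓ₁ ℓ₂) where
  open OrderedField F using (_≤_; _*_)
  open OrderedField F public using (Carrier; _≈_; _+_; _-_; 0#; 1#; fromℕ)
    renaming (_≤_ to _≤F_; _*_ to _·_)

  sumF : ∀ {k} → (Fin k → Carrier) → Carrier
  sumF {zero}  f = 0#
  sumF {suc k} f = f zero + sumF (λ i → f (suc i))

  -- A multigraph on vertex set Fin n with edge set Fin m, each edge e
  -- having endpoints  ends e = (a , b)  (V(e) = {a , b}).  Utility/cost functions: u e α β is the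
  -- utility of edge e when its first endpoint a gets label α and its
  -- second endpoint b gets label β (it depends only on these labels).

  FracAssign : ℕ → ℕ → Set c
  FracAssign n s = Fin n → Fin s → Carrier

  -- a 1/(2K)-integral assignment is represented by its numerators
  -- N v α (natural numbers with Σ_α N v α = 2K); its values are
  -- λ_α(v) = κ · N v α  where κ = 1/(2K).
  NumAssign : ℕ → ℕ → Set
  NumAssign n s = Fin n → Fin s → ℕ

  values : ∀ {n s} → Carrier → NumAssign n s → FracAssign n s
  values κ N v α = κ * fromℕ (N v α)

  incident : ∀ {n m} → (Fin m → Fin n × Fin n) → Fin m → Fin n → Bool
  incident ends e v = does (proj₁ (ends e) ≟ v) Data.Bool.∨ does (proj₂ (ends e) ≟ v)

  module _ {n m s : ℕ} (ends : Fin m → Fin n × Fin n)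
           (f : Fin m → Fin s → Fin s → Carrier) where

    edgeVal : FracAssign n s → Fin m → Carrier
    edgeVal Λ e = sumF (λ α → sumF (λ β →
                    (Λ (proj₁ (ends e)) α * Λ (proj₂ (ends e)) β) * f e α β))

    setVal : (Fin m → Bool) → FracAssign n s → Carrier
    setVal S Λ = sumF (λ e → if S e then edgeVal Λ e else 0#)

    totVal : FracAssign n s → Carrier
    totVal = setVal (λ _ → true)

  WADefective : ∀ {n m p} → (Fin m → Fin n × Fin n) → Carrier →
                (Fin m → Carrier) → (Fin n → Fin p) → Set ℓ₂
  WADefective ends ε w φ =
    sumF (λ v → sumF (λ e →
      if incident ends e v ∧ does (φ (proj₁ (ends e)) ≟ φ (proj₂ (ends e)))
      then w e else 0#))
    ≤ ε * sumF (λ v → sumF (λ e → if incident ends e v then w e else 0#))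

  pointAt : ∀ {n s} → FracAssign n s → Fin n → Fin s → FracAssign n s
  pointAt Λ v α w β =
    if does (w ≟ v) then (if does (β ≟ α) then 1# else 0#) else Λ w β

  module Step {n m s p : ℕ} (ends : Fin m → Fin n × Fin n)
              (util cost : Fin m → Fin s → Fin s → Carrier)
              (κ δ η sixth : Carrier)
              (φ : Fin n → Fin p) where

    Eb : Fin n → Fin m → Bool
    Eb v e = incident ends e v ∧ not (does (φ (proj₁ (ends e)) ≟ φ (proj₂ (ends e))))

    -- Σ_v w.r.t. the current assignment N: labels with odd numerator,
    -- i.e. λ_α(v) = (2i+1)/(2K) for some i ≥ 0
    inΣ : NumAssign n s → Fin n → Fin s → Bool
    inΣ N v α = isOdd (N v α)

    phiVal : NumAssign n s → Fin n → Fin s → Carrier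
    phiVal N v α = setVal ends util (Eb v) (pointAt (values κ N) v α)
                   - η * setVal ends cost (Eb v) (pointAt (values κ N) v α)

    thetaVal : NumAssign n s → Fin n → Fin s → Carrier
    thetaVal N v α = setVal ends util (Eb v) (pointAt (values κ N) v α)
                     + η * setVal ends cost (Eb v) (pointAt (values κ N) v α)

    -- A valid update of node v (given the assignment N at the start of
    -- the phase) producing new numerators `row` for v: a choice of
    -- estimates φ̂ and a balanced partition Σ_v = Σ_v⁺ ⊎ Σ_v⁻
    -- (plus α = true means α ∈ Σ_v⁺), and the resulting ±1/(2K) update.
    record NodeUpdate (N : NumAssign n s) (v : Fin n) (row : Fin s → ℕ)
           : Set (c ⊔ ℓ₂) where
      field
        plus     : Fin s → Bool
        hat      : Fin s → Carrier
        hat-up   : ∀ α → inΣ N v α ≡ true → hat α ≤ phiVal N v α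
        hat-low  : ∀ α → inΣ N v α ≡ true →
                   (phiVal N v α - (δ * sixth) * thetaVal N v α) ≤ hat α
        balanced : count (λ α → inΣ N v α ∧ plus α)
                   ≡ count (λ α → inΣ N v α ∧ not (plus α))
        ordered  : ∀ α β → inΣ N v α ≡ true → plus α ≡ true →
                   inΣ N v β ≡ true → plus β ≡ false → hat β ≤ hat α
        newRow   : ∀ α → (inΣ N v α ≡ true × plus α ≡ true × row α ≡ suc (N v α))
                         ⊎ (inΣ N v α ≡ true × plus α ≡ false × suc (row α) ≡ N v α)
                         ⊎ (inΣ N v α ≡ false × row α ≡ N v α)

    -- one phase γ: all nodes of colour γ update in parallel (w.r.t. N),
    -- all other nodes are unchanged
    record Phase (γ : Fin p) (N N' : NumAssign n s) : Set (c ⊔ ℓ₂) where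
      field
        active   : ∀ v → φ v ≡ γ → NodeUpdate N v (N' v)
        inactive : ∀ v → φ v ≢ γ → ∀ α → N' v α ≡ N v α

    data Run : List (Fin p) → NumAssign n s → NumAssign n s → Set (c ⊔ ℓ₂) where
      done : ∀ {N} → Run [] N N
      step : ∀ {γ γs N N₁ N₂} → Phase γ N N₁ → Run γs N₁ N₂ → Run (γ ∷ γs) N N₂

-- The colour classes are rounded one after another, and the proof tracks the potential
--   value(current assignment) + Σₑ charge(e),   charge(e) = rate(e) · (g₁ g₂ − 1) · wₑ,
-- where gᵢ = 2 if the i-th endpoint of e has already been rounded and gᵢ = 1 otherwise (rounding at
-- most doubles a label), and rate(e) is 1 on monochromatic and δ/6 on bichromatic edges.  A phase
-- never decreases the potential: the objective is linear in the labels of a single node v, so the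
-- balanced split of Σ_v by the estimates φ̂ loses at most (δ/6) θ on the labels of Σ_v⁻, i.e. at most
-- (δ/6) w(E_b(v)) under the current labels, which is the charge released on the bichromatic edges
-- of v; a monochromatic edge inside the colour class loses at most u + 3ηc ≤ 3 wₑ, its whole charge.
-- The potential starts at value(λ) and ends at most at value(λ′) + 3 (w(E ∖ E_b) + (δ/6) w(E)),
-- and the defective colouring gives w(E ∖ E_b) ≤ (δ/6) w(E).  Integrality: only odd numerators
-- move, by one, and |Σ_v⁺| = |Σ_v⁻| keeps every row sum.

module Submission where

open import Defs
open import Algebra.Bundles using (CommutativeRing)
open import Level using (Level)
open import Data.Nat as ℕ using (ℕ; zero; suc; _%_)
import Data.Nat.Properties as ℕ
open import Function using (_∘_)
open import Data.Integer as ℤ using (ℤ; +_; -[1+_])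
import Data.Integer.Properties as ℤ
open import Data.Sign as Sign using (Sign)
open import Data.Maybe using (Maybe; just; nothing)
open import Data.Sum using (_⊎_; inj₁; inj₂; [_,_]′)
open import Data.Product using (∃; _×_; _,_; proj₁; proj₂)
open import Data.Bool using (Bool; true; false; if_then_else_; _∧_; not)
open import Relation.Nullary using (Dec; yes; no; does; contradiction)
open import Relation.Binary using (IsTotalOrder; Poset)
import Relation.Binary.Reasoning.PartialOrder as PosetReasoning
import Relation.Binary.Reasoning.Setoid as ≈-Reasoning
open import Relation.Nullary.Decidable using (dec-true; dec-false)
open import Data.List using (List; _∷_; allFin)
open import Data.List.Relation.Unary.Any using (here; there)
import Data.List.Relation.Unary.All as All
open import Data.List.Relation.Unary.AllPairs using (_∷_)
open import Data.List.Relation.Unary.Unique.Propositional using (Unique)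
open import Data.List.Relation.Unary.Unique.Propositional.Properties using (allFin⁺)
open import Data.List.Membership.Propositional.Properties using (∈-allFin)
open import Relation.Binary.PropositionalEquality as ≡ using (_≡_; _≢_)
open import Data.Fin using (Fin; zero; suc; _≟_)
import Data.Fin.Properties as Fin
import Algebra.Properties.Ring as RingProperties
import Algebra.Properties.CommutativeSemigroup as CommutativeSemigroupProperties
open import Algebra.Solver.Ring.AlmostCommutativeRing
  using (AlmostCommutativeRing; fromCommutativeRing; _-Raw-AlmostCommutative⟶_)
import Algebra.Solver.Ring

-- The shape of NodeUpdate.newRow at a single label with numerator x and new numerator r.
RowStep : Bool → Bool → ℕ → ℕ → Set
RowStep odd plus r x = (odd ≡ true × plus ≡ true × r ≡ suc x)
                     ⊎ (odd ≡ true × plus ≡ false × suc r ≡ x)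
                     ⊎ (odd ≡ false × r ≡ x)

∧≡true⇒ : ∀ {x y} → x ∧ y ≡ true → x ≡ true × y ≡ true
∧≡true⇒ {true} {true} _ = ≡.refl , ≡.refl

not≡true⇒ : ∀ {x} → not x ≡ true → x ≡ false
not≡true⇒ {false} _ = ≡.refl

sumℕ-cong : ∀ {k} {f g : Fin k → ℕ} → (∀ i → f i ≡ g i) → sumℕ f ≡ sumℕ g
sumℕ-cong {zero}  f≡g = ≡.refl
sumℕ-cong {suc k} f≡g = ≡.cong₂ ℕ._+_ (f≡g zero) (sumℕ-cong (f≡g ∘ suc))

sumℕ-distrib-+ : ∀ {k} (f g : Fin k → ℕ) → sumℕ (λ i → f i ℕ.+ g i) ≡ sumℕ f ℕ.+ sumℕ g
sumℕ-distrib-+ {zero}  f g = ≡.refl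
sumℕ-distrib-+ {suc k} f g = ≡.trans (≡.cong (f zero ℕ.+ g zero ℕ.+_) (sumℕ-distrib-+ (f ∘ suc) (g ∘ suc)))
                                     (+-interchange (f zero) (g zero) _ _)
  where open CommutativeSemigroupProperties ℕ.+-commutativeSemigroup using () renaming (interchange to +-interchange)

%2-alternates : ∀ k → (k % 2 ≡ 0 × suc k % 2 ≡ 1) ⊎ (k % 2 ≡ 1 × suc k % 2 ≡ 0)
%2-alternates zero    = inj₁ (≡.refl , ≡.refl)
%2-alternates (suc k) with %2-alternates k
... | inj₁ (k%2≡0 , 1+k%2≡1) = inj₂ (1+k%2≡1 , k%2≡0)
... | inj₂ (k%2≡1 , 1+k%2≡0) = inj₁ (1+k%2≡0 , k%2≡1)

RowStep-even : ∀ {plus r} x → RowStep (isOdd x) plus r x → Even r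
RowStep-even x (inj₁ (odd , _ , ≡.refl)) with %2-alternates x
... | inj₁ (x%2≡0 , _) rewrite x%2≡0 = contradiction odd λ ()
... | inj₂ (_ , 1+x%2≡0)             = 1+x%2≡0
RowStep-even {r = r} .(suc r) (inj₂ (inj₁ (odd , _ , ≡.refl))) with %2-alternates r
... | inj₁ (r%2≡0 , _)               = r%2≡0
... | inj₂ (_ , 1+r%2≡0) rewrite 1+r%2≡0 = contradiction odd λ ()
RowStep-even x (inj₂ (inj₂ (even , ≡.refl))) with %2-alternates x
... | inj₁ (x%2≡0 , _)               = x%2≡0
... | inj₂ (x%2≡1 , _) rewrite x%2≡1 = contradiction even λ ()

RowStep-≤-double : ∀ {odd plus r x} → RowStep odd plus r x → (odd ≡ true → 1 ℕ.≤ x) → r ℕ.≤ 2 ℕ.* x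
RowStep-≤-double {x = x} (inj₁ (odd , _ , ≡.refl)) 1≤x =
  ℕ.≤-trans (ℕ.+-monoˡ-≤ x (1≤x odd)) (ℕ.≤-reflexive (≡.cong (x ℕ.+_) (≡.sym (ℕ.+-identityʳ x))))
RowStep-≤-double {r = r} (inj₂ (inj₁ (_ , _ , ≡.refl))) _ = ℕ.≤-trans (ℕ.n≤1+n r) (ℕ.m≤m+n (suc r) _)
RowStep-≤-double {x = x} (inj₂ (inj₂ (_ , ≡.refl))) _ = ℕ.m≤m+n x _

RowStep-sum : ∀ {odd plus r x} → RowStep odd plus r x →
              r ℕ.+ (if odd ∧ not plus then 1 else 0) ≡ x ℕ.+ (if odd ∧ plus then 1 else 0)
RowStep-sum {x = x} (inj₁ (≡.refl , ≡.refl , ≡.refl)) = ≡.trans (≡.cong suc (ℕ.+-identityʳ x)) (ℕ.+-comm 1 x)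
RowStep-sum {r = r} (inj₂ (inj₁ (≡.refl , ≡.refl , ≡.refl))) = ≡.trans (ℕ.+-comm r 1) (≡.sym (ℕ.+-identityʳ (suc r)))
RowStep-sum (inj₂ (inj₂ (≡.refl , ≡.refl))) = ≡.refl

-- Every commutative ring receives the canonical homomorphism from ℤ, so the ring solver applies with
-- integer coefficients.  The embedding sends 1 to 1# itself, so that the constant 1 of the solver
-- denotes 1# on the nose.
module IntegerCoefficients {c ℓ} (R : CommutativeRing c ℓ) where

  open CommutativeRing R
  open RingProperties ring using (-0#≈0#; -‿involutive; -‿+-comm; -‿distribˡ-*; -‿distribʳ-*)
  open CommutativeSemigroupProperties +-commutativeSemigroup using () renaming (interchange to +-interchange)

  ι : ℕ → Carrier
  ι zero          = 0#
  ι (suc zero)    = 1#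
  ι (suc (suc k)) = 1# + ι (suc k)

  ι-suc : ∀ k → ι (suc k) ≈ 1# + ι k
  ι-suc zero    = sym (+-identityʳ 1#)
  ι-suc (suc k) = refl

  ι-+ : ∀ j k → ι (j ℕ.+ k) ≈ ι j + ι k
  ι-+ zero    k = sym (+-identityˡ _)
  ι-+ (suc j) k = trans (ι-suc (j ℕ.+ k))
    (trans (+-congˡ (ι-+ j k)) (trans (sym (+-assoc _ _ _)) (+-congʳ (sym (ι-suc j)))))

  ι-* : ∀ j k → ι (j ℕ.* k) ≈ ι j * ι k
  ι-* zero    k = sym (zeroˡ _)
  ι-* (suc j) k = trans (ι-+ k (j ℕ.* k))
    (trans (+-cong (sym (*-identityˡ _)) (ι-* j k)) (trans (sym (distribʳ _ _ _)) (*-congʳ (sym (ι-suc j)))))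

  ⟦_⟧ : ℤ → Carrier
  ⟦ + k      ⟧ = ι k
  ⟦ -[1+ k ] ⟧ = - ι (suc k)

  ⊖-homo : ∀ j k → ⟦ j ℤ.⊖ k ⟧ ≈ ι j - ι k
  ⊖-homo j       zero    = sym (trans (+-congˡ -0#≈0#) (+-identityʳ _))
  ⊖-homo zero    (suc k) = sym (+-identityˡ _)
  ⊖-homo (suc j) (suc k) =
    trans (reflexive (≡.cong ⟦_⟧ (ℤ.[1+m]⊖[1+n]≡m⊖n j k))) (trans (⊖-homo j k) (sym cancel-1))
    where
    cancel-1 : ι (suc j) - ι (suc k) ≈ ι j - ι k
    cancel-1 = trans (+-cong (ι-suc j) (trans (-‿cong (ι-suc k)) (sym (-‿+-comm 1# (ι k)))))
      (trans (+-interchange 1# (ι j) (- 1#) (- ι k)) (trans (+-congʳ (-‿inverseʳ 1#)) (+-identityˡ _)))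

  +-homo : ∀ i j → ⟦ i ℤ.+ j ⟧ ≈ ⟦ i ⟧ + ⟦ j ⟧
  +-homo (+ j)      (+ k)      = ι-+ j k
  +-homo (+ j)      -[1+ k ]   = ⊖-homo j (suc k)
  +-homo -[1+ j ]   (+ k)      = trans (⊖-homo k (suc j)) (+-comm _ _)
  +-homo -[1+ j ]   -[1+ k ]   =
    trans (-‿cong (trans (reflexive (≡.cong (ι ∘ suc) (≡.sym (ℕ.+-suc j k)))) (ι-+ (suc j) (suc k))))
          (sym (-‿+-comm _ _))

  -‿homo : ∀ i → ⟦ ℤ.- i ⟧ ≈ - ⟦ i ⟧
  -‿homo (+ zero)  = sym -0#≈0#
  -‿homo (+ suc k) = refl
  -‿homo -[1+ k ]  = sym (-‿involutive _)

  signed : Sign → Carrier → Carrier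
  signed Sign.+ x = x
  signed Sign.- x = - x

  ◃-homo : ∀ σ k → ⟦ σ ℤ.◃ k ⟧ ≈ signed σ (ι k)
  ◃-homo Sign.+ zero    = refl
  ◃-homo Sign.- zero    = sym -0#≈0#
  ◃-homo Sign.+ (suc k) = refl
  ◃-homo Sign.- (suc k) = refl

  signed-cong : ∀ σ {x y} → x ≈ y → signed σ x ≈ signed σ y
  signed-cong Sign.+ x≈y = x≈y
  signed-cong Sign.- x≈y = -‿cong x≈y

  signed-* : ∀ σ τ x y → signed (σ Sign.* τ) (x * y) ≈ signed σ x * signed τ y
  signed-* Sign.+ Sign.+ x y = refl
  signed-* Sign.+ Sign.- x y = -‿distribʳ-* x y
  signed-* Sign.- Sign.+ x y = -‿distribˡ-* x y
  signed-* Sign.- Sign.- x y =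
    trans (sym (-‿involutive _)) (trans (-‿cong (-‿distribˡ-* x y)) (-‿distribʳ-* (- x) y))

  *-homo : ∀ i j → ⟦ i ℤ.* j ⟧ ≈ ⟦ i ⟧ * ⟦ j ⟧
  *-homo i j = trans (◃-homo (ℤ.sign i Sign.* ℤ.sign j) (ℤ.∣ i ∣ ℕ.* ℤ.∣ j ∣))
    (trans (signed-cong (ℤ.sign i Sign.* ℤ.sign j) (ι-* ℤ.∣ i ∣ ℤ.∣ j ∣))
      (trans (signed-* (ℤ.sign i) (ℤ.sign j) _ _) (*-cong (sym (signed-abs i)) (sym (signed-abs j)))))
    where
    signed-abs : ∀ i → ⟦ i ⟧ ≈ signed (ℤ.sign i) (ι ℤ.∣ i ∣)
    signed-abs (+ k)      = refl
    signed-abs -[1+ k ]   = refl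

  almostCommutativeRing : AlmostCommutativeRing c ℓ
  almostCommutativeRing = fromCommutativeRing R

  homomorphism : ℤ.+-*-rawRing -Raw-AlmostCommutative⟶ almostCommutativeRing
  homomorphism = record
    { ⟦_⟧ = ⟦_⟧ ; +-homo = +-homo ; *-homo = *-homo ; -‿homo = -‿homo ; 0-homo = refl ; 1-homo = refl }

  equal? : ∀ i j → Maybe (⟦ i ⟧ ≈ ⟦ j ⟧)
  equal? i j with i ℤ.≟ j
  ... | yes ≡.refl = just refl
  ... | no _       = nothing

  open Algebra.Solver.Ring ℤ.+-*-rawRing almostCommutativeRing homomorphism equal? public
    using (solve; _:+_; _:*_; _:-_; _:=_; con)

module OrderedFieldProperties {c ℓ₁ ℓ₂} (F : OrderedField c ℓ₁ ℓ₂) where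

  open OrderedField F public hiding (zero) renaming (+-mono-≤ to +-monoˡ-≤)
  open RingProperties ring public
    using (-0#≈0#; -‿involutive; -‿+-comm; -‿distribˡ-*; x[y-z]≈xy-xz)
  open CommutativeSemigroupProperties +-commutativeSemigroup public
    using () renaming (interchange to +-interchange)
  open CommutativeSemigroupProperties *-commutativeSemigroup public
    using () renaming (interchange to *-interchange; x∙yz≈y∙xz to *-leftComm)
  open IsTotalOrder isTotalOrder public
    using (total; antisym) renaming (refl to ≤-refl; reflexive to ≤-reflexive; trans to ≤-trans)

  open IntegerCoefficients commutativeRing public using (ι; solve; _:+_; _:*_; _:-_; _:=_; con)

  two three : Carrier
  two   = 1# + 1#
  three = 1# + two

  poset : Poset c ℓ₁ ℓ₂
  poset = record { isPartialOrder = IsTotalOrder.isPartialOrder isTotalOrder }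

  module ≤-Reasoning = PosetReasoning poset

  ≤-respˡ-≈ : ∀ {x y z} → x ≈ y → x ≤ z → y ≤ z
  ≤-respˡ-≈ x≈y x≤z = ≤-trans (≤-reflexive (sym x≈y)) x≤z

  ≤-respʳ-≈ : ∀ {x y z} → y ≈ z → x ≤ y → x ≤ z
  ≤-respʳ-≈ y≈z x≤y = ≤-trans x≤y (≤-reflexive y≈z)

  +-monoʳ-≤ : ∀ {x y} z → x ≤ y → z + x ≤ z + y
  +-monoʳ-≤ {x} {y} z x≤y = ≤-respˡ-≈ (+-comm x z) (≤-respʳ-≈ (+-comm y z) (+-monoˡ-≤ z x≤y))

  +-mono-≤ : ∀ {x y u v} → x ≤ y → u ≤ v → x + u ≤ y + v
  +-mono-≤ x≤y u≤v = ≤-trans (+-monoˡ-≤ _ x≤y) (+-monoʳ-≤ _ u≤v)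

  x≤y⇒0≤y-x : ∀ {x y} → x ≤ y → 0# ≤ y - x
  x≤y⇒0≤y-x {x} x≤y = ≤-respˡ-≈ (-‿inverseʳ x) (+-monoˡ-≤ (- x) x≤y)

  0≤y-x⇒x≤y : ∀ {x y} → 0# ≤ y - x → x ≤ y
  0≤y-x⇒x≤y {x} {y} 0≤y-x = ≤-respˡ-≈ (+-identityˡ x) (≤-respʳ-≈ y-x+x≈y (+-monoˡ-≤ x 0≤y-x))
    where
    y-x+x≈y : y - x + x ≈ y
    y-x+x≈y = trans (+-assoc y (- x) x) (trans (+-congˡ (-‿inverseˡ x)) (+-identityʳ y))

  -‿antimono-≤ : ∀ {x y} → x ≤ y → - y ≤ - x
  -‿antimono-≤ {x} {y} x≤y =
    0≤y-x⇒x≤y (≤-respʳ-≈ (trans (+-comm y (- x)) (+-congˡ (sym (-‿involutive y)))) (x≤y⇒0≤y-x x≤y))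

  x≤0⇒0≤-x : ∀ {x} → x ≤ 0# → 0# ≤ - x
  x≤0⇒0≤-x x≤0 = ≤-respˡ-≈ -0#≈0# (-‿antimono-≤ x≤0)

  +-nonneg : ∀ {x y} → 0# ≤ x → 0# ≤ y → 0# ≤ x + y
  +-nonneg 0≤x 0≤y = ≤-respˡ-≈ (+-identityʳ 0#) (+-mono-≤ 0≤x 0≤y)

  *-monoˡ-≤-nonneg : ∀ {x y} z → 0# ≤ z → x ≤ y → z * x ≤ z * y
  *-monoˡ-≤-nonneg {x} {y} z 0≤z x≤y =
    0≤y-x⇒x≤y (≤-respʳ-≈ (x[y-z]≈xy-xz z y x) (*-nonneg 0≤z (x≤y⇒0≤y-x x≤y)))

  *-monoʳ-≤-nonneg : ∀ {x y} z → 0# ≤ z → x ≤ y → x * z ≤ y * z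
  *-monoʳ-≤-nonneg {x} {y} z 0≤z x≤y =
    ≤-respˡ-≈ (*-comm z x) (≤-respʳ-≈ (*-comm z y) (*-monoˡ-≤-nonneg z 0≤z x≤y))

  *-mono-≤-nonneg : ∀ {x y u v} → 0# ≤ x → 0# ≤ u → x ≤ y → u ≤ v → x * u ≤ y * v
  *-mono-≤-nonneg {y = y} {u = u} 0≤x 0≤u x≤y u≤v =
    ≤-trans (*-monoʳ-≤-nonneg u 0≤u x≤y) (*-monoˡ-≤-nonneg y (≤-trans 0≤x x≤y) u≤v)

  -- In an ordered ring squares are non-negative, so 1# ≤ 0# would give 0# ≤ - 1# * - 1# ≈ 1#.
  0≤1 : 0# ≤ 1#
  0≤1 with total 0# 1#
  ... | inj₁ 0≤1 = 0≤1
  ... | inj₂ 1≤0 = ≤-respʳ-≈ -1*-1≈1 (*-nonneg (x≤0⇒0≤-x 1≤0) (x≤0⇒0≤-x 1≤0))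
    where
    -1*-1≈1 : - 1# * - 1# ≈ 1#
    -1*-1≈1 = trans (sym (-‿distribˡ-* 1# (- 1#))) (trans (-‿cong (*-identityˡ (- 1#))) (-‿involutive 1#))

  three-nonneg : 0# ≤ three
  three-nonneg = +-nonneg 0≤1 (+-nonneg 0≤1 0≤1)

  0≤x*y≈1⇒0≤x : ∀ {x y} → 0# ≤ y → x * y ≈ 1# → 0# ≤ x
  0≤x*y≈1⇒0≤x {x} {y} 0≤y xy≈1 with total 0# x
  ... | inj₁ 0≤x = 0≤x
  ... | inj₂ x≤0 = contradiction (antisym 0≤1 1≤0) 0≉1
    where
    0≤-1 : 0# ≤ - 1#
    0≤-1 = ≤-respʳ-≈ (trans (sym (-‿distribˡ-* x y)) (-‿cong xy≈1)) (*-nonneg (x≤0⇒0≤-x x≤0) 0≤y)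
    1≤0 : 1# ≤ 0#
    1≤0 = ≤-respˡ-≈ (-‿involutive 1#) (≤-respʳ-≈ -0#≈0# (-‿antimono-≤ 0≤-1))

  fromℕ-nonneg : ∀ k → 0# ≤ fromℕ k
  fromℕ-nonneg zero    = ≤-refl
  fromℕ-nonneg (suc k) = +-nonneg 0≤1 (fromℕ-nonneg k)

  fromℕ-mono-≤ : ∀ {j k} → j ℕ.≤ k → fromℕ j ≤ fromℕ k
  fromℕ-mono-≤ {k = k} ℕ.z≤n = fromℕ-nonneg k
  fromℕ-mono-≤ (ℕ.s≤s j≤k) = +-monoʳ-≤ 1# (fromℕ-mono-≤ j≤k)

  fromℕ≈ι : ∀ k → fromℕ k ≈ ι k
  fromℕ≈ι zero          = refl
  fromℕ≈ι (suc zero)    = +-identityʳ 1#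
  fromℕ≈ι (suc (suc k)) = +-congˡ (fromℕ≈ι (suc k))

  fromℕ-+ : ∀ j k → fromℕ (j ℕ.+ k) ≈ fromℕ j + fromℕ k
  fromℕ-+ zero    k = sym (+-identityˡ _)
  fromℕ-+ (suc j) k = trans (+-congˡ (fromℕ-+ j k)) (sym (+-assoc _ _ _))

  fromℕ-* : ∀ j k → fromℕ (j ℕ.* k) ≈ fromℕ j * fromℕ k
  fromℕ-* zero    k = sym (zeroˡ _)
  fromℕ-* (suc j) k =
    trans (fromℕ-+ k (j ℕ.* k)) (trans (+-cong (sym (*-identityˡ _)) (fromℕ-* j k)) (sym (distribʳ _ _ _)))

module _ {a ℓ₁ ℓ₂} (F : OrderedField a ℓ₁ ℓ₂) where

  open OrderedFieldProperties F
  open Rounding F using (sumF; edgeVal; setVal; pointAt; incident; FracAssign; NumAssign; values; WADefective; totVal)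

  sumF-cong : ∀ {k} {f g : Fin k → Carrier} → (∀ i → f i ≈ g i) → sumF f ≈ sumF g
  sumF-cong {zero}  f≈g = refl
  sumF-cong {suc k} f≈g = +-cong (f≈g zero) (sumF-cong (f≈g ∘ suc))

  sumF-mono-≤ : ∀ {k} {f g : Fin k → Carrier} → (∀ i → f i ≤ g i) → sumF f ≤ sumF g
  sumF-mono-≤ {zero}  f≤g = ≤-refl
  sumF-mono-≤ {suc k} f≤g = +-mono-≤ (f≤g zero) (sumF-mono-≤ (f≤g ∘ suc))

  sumF-nonneg : ∀ {k} {f : Fin k → Carrier} → (∀ i → 0# ≤ f i) → 0# ≤ sumF f
  sumF-nonneg {zero}  0≤f = ≤-refl
  sumF-nonneg {suc k} 0≤f = +-nonneg (0≤f zero) (sumF-nonneg (0≤f ∘ suc))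

  sumF-zero : ∀ {k} {f : Fin k → Carrier} → (∀ i → f i ≈ 0#) → sumF f ≈ 0#
  sumF-zero {zero}  f≈0 = refl
  sumF-zero {suc k} f≈0 = trans (+-cong (f≈0 zero) (sumF-zero (f≈0 ∘ suc))) (+-identityʳ 0#)

  sumF-distrib-+ : ∀ {k} (f g : Fin k → Carrier) → sumF (λ i → f i + g i) ≈ sumF f + sumF g
  sumF-distrib-+ {zero}  f g = sym (+-identityʳ 0#)
  sumF-distrib-+ {suc k} f g =
    trans (+-congˡ (sumF-distrib-+ (f ∘ suc) (g ∘ suc))) (+-interchange _ _ _ _)

  sumF-distrib-sub : ∀ {k} (f g : Fin k → Carrier) → sumF (λ i → f i - g i) ≈ sumF f - sumF g
  sumF-distrib-sub {zero}  f g = sym (trans (+-congˡ -0#≈0#) (+-identityʳ 0#))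
  sumF-distrib-sub {suc k} f g = trans (+-congˡ (sumF-distrib-sub (f ∘ suc) (g ∘ suc)))
    (trans (+-interchange _ _ _ _) (+-congˡ (-‿+-comm _ _)))

  *-distribˡ-sumF : ∀ {k} x (f : Fin k → Carrier) → sumF (λ i → x * f i) ≈ x * sumF f
  *-distribˡ-sumF {zero}  x f = sym (zeroʳ x)
  *-distribˡ-sumF {suc k} x f = trans (+-congˡ (*-distribˡ-sumF x (f ∘ suc))) (sym (distribˡ x _ _))

  sumF-comm : ∀ {k l} (f : Fin k → Fin l → Carrier) →
              sumF (λ i → sumF (λ j → f i j)) ≈ sumF (λ j → sumF (λ i → f i j))
  sumF-comm {zero} {l} f = sym (sumF-zero {l} (λ _ → refl))
  sumF-comm {suc k} f =
    trans (+-congˡ (sumF-comm (f ∘ suc))) (sym (sumF-distrib-+ (f zero) (λ j → sumF (λ i → f (suc i) j))))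

  sumF-single : ∀ {k} (f : Fin k → Carrier) j → (∀ i → i ≢ j → f i ≈ 0#) → sumF f ≈ f j
  sumF-single f zero    f≈0 = trans (+-congˡ (sumF-zero (λ i → f≈0 (suc i) λ ()))) (+-identityʳ _)
  sumF-single f (suc j) f≈0 = trans (+-cong (f≈0 zero λ ()) (sumF-single (f ∘ suc) j
    (λ i i≢j → f≈0 (suc i) (i≢j ∘ Fin.suc-injective)))) (+-identityˡ _)

  ind : Bool → Carrier → Carrier
  ind b x = if b then x else 0#

  ind-cong : ∀ b {x y} → x ≈ y → ind b x ≈ ind b y
  ind-cong true  x≈y = x≈y
  ind-cong false x≈y = refl

  ind-mono-≤ : ∀ b {x y} → (b ≡ true → x ≤ y) → ind b x ≤ ind b y
  ind-mono-≤ true  x≤y = x≤y ≡.refl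
  ind-mono-≤ false x≤y = ≤-refl

  ind-nonneg : ∀ b {x} → (b ≡ true → 0# ≤ x) → 0# ≤ ind b x
  ind-nonneg true  0≤x = 0≤x ≡.refl
  ind-nonneg false 0≤x = ≤-refl

  ind-zero : ∀ b {x} → (b ≡ true → x ≈ 0#) → ind b x ≈ 0#
  ind-zero true  x≈0 = x≈0 ≡.refl
  ind-zero false x≈0 = refl

  ind-distrib-+ : ∀ b x y → ind b (x + y) ≈ ind b x + ind b y
  ind-distrib-+ true  x y = refl
  ind-distrib-+ false x y = sym (+-identityʳ 0#)

  ind-distrib-sub : ∀ b x y → ind b (x - y) ≈ ind b x - ind b y
  ind-distrib-sub true  x y = refl
  ind-distrib-sub false x y = sym (-‿inverseʳ 0#)

  ind-*ˡ : ∀ b x y → ind b (x * y) ≈ x * ind b y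
  ind-*ˡ true  x y = refl
  ind-*ˡ false x y = sym (zeroʳ x)

  ind-∧ : ∀ b₁ b₂ x → ind (b₁ ∧ b₂) x ≈ ind b₂ (ind b₁ x)
  ind-∧ true  b₂    x = refl
  ind-∧ false true  x = refl
  ind-∧ false false x = refl

  ind-sumF : ∀ {k} b (f : Fin k → Carrier) → ind b (sumF f) ≈ sumF (λ i → ind b (f i))
  ind-sumF true  f = refl
  ind-sumF {k} false f = sym (sumF-zero {k} (λ _ → refl))

  sumF-ind-const : ∀ {k} (P : Fin k → Bool) x → sumF (λ i → ind (P i) x) ≈ fromℕ (count P) * x
  sumF-ind-const {zero}  P x = sym (zeroˡ x)
  sumF-ind-const {suc k} P x = trans (+-cong (head (P zero)) (sumF-ind-const (P ∘ suc) x))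
    (trans (sym (distribʳ x _ _)) (*-congʳ (sym (fromℕ-+ (if P zero then 1 else 0) (count (P ∘ suc))))))
    where
    head : ∀ b → ind b x ≈ fromℕ (if b then 1 else 0) * x
    head true  = sym (trans (*-congʳ (+-identityʳ 1#)) (*-identityˡ x))
    head false = sym (zeroˡ x)

  count≡0⇒false : ∀ {k} (P : Fin k → Bool) → count P ≡ 0 → ∀ i → P i ≡ false
  count≡0⇒false P count≡0 zero    with P zero
  ... | false = ≡.refl
  count≡0⇒false P count≡0 (suc i) with P zero
  ... | false = count≡0⇒false (P ∘ suc) count≡0 i

  false⇒count≡0 : ∀ {k} (P : Fin k → Bool) → (∀ i → P i ≡ false) → count P ≡ 0
  false⇒count≡0 {zero}  P P≡false = ≡.refl
  false⇒count≡0 {suc k} P P≡false rewrite P≡false zero = false⇒count≡0 (P ∘ suc) (P≡false ∘ suc)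

  argmin : ∀ {k} (P : Fin k → Bool) (f : Fin k → Carrier) →
           (∀ i → P i ≡ false) ⊎ ∃ λ j → P j ≡ true × (∀ i → P i ≡ true → f j ≤ f i)
  argmin {zero}  P f = inj₁ λ ()
  argmin {suc k} P f with argmin (P ∘ suc) (f ∘ suc) | P zero in P0
  ... | inj₁ P∘suc≡false | false = inj₁ λ { zero → P0 ; (suc i) → P∘suc≡false i }
  ... | inj₁ P∘suc≡false | true  = inj₂ (zero , P0 , λ
    { zero _ → ≤-refl ; (suc i) Pi → contradiction (≡.trans (≡.sym Pi) (P∘suc≡false i)) λ () })
  ... | inj₂ (j , Pj , min) | false = inj₂ (suc j , Pj , λ
    { zero P0′ → contradiction (≡.trans (≡.sym P0′) P0) λ () ; (suc i) Pi → min i Pi })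
  ... | inj₂ (j , Pj , min) | true with total (f zero) (f (suc j))
  ...   | inj₁ f0≤fj = inj₂ (zero , P0 , λ { zero _ → ≤-refl ; (suc i) Pi → ≤-trans f0≤fj (min i Pi) })
  ...   | inj₂ fj≤f0 = inj₂ (suc j , Pj , λ { zero _ → fj≤f0 ; (suc i) Pi → min i Pi })

  sumF-ind-≤-balanced : ∀ {k} (P Q : Fin k → Bool) (f : Fin k → Carrier) → count P ≡ count Q →
                        (∀ i j → P i ≡ true → Q j ≡ true → f j ≤ f i) →
                        sumF (λ i → ind (Q i) (f i)) ≤ sumF (λ i → ind (P i) (f i))
  sumF-ind-≤-balanced P Q f |P|≡|Q| Q≤P with argmin P f
  ... | inj₁ P≡false = ≤-reflexive (trans (empty Q Q≡false) (sym (empty P P≡false)))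
    where
    Q≡false : ∀ i → Q i ≡ false
    Q≡false = count≡0⇒false Q (≡.trans (≡.sym |P|≡|Q|) (false⇒count≡0 P P≡false))
    empty : ∀ R → (∀ i → R i ≡ false) → sumF (λ i → ind (R i) (f i)) ≈ 0#
    empty R R≡false = sumF-zero λ i → ind-zero (R i) λ Ri → contradiction (≡.trans (≡.sym Ri) (R≡false i)) λ ()
  ... | inj₂ (j , Pj , min) = begin
    sumF (λ i → ind (Q i) (f i))   ≤⟨ sumF-mono-≤ (λ i → ind-mono-≤ (Q i) (Q≤P j i Pj)) ⟩
    sumF (λ i → ind (Q i) (f j))   ≈⟨ sumF-ind-const Q (f j) ⟩
    fromℕ (count Q) * f j          ≡⟨ ≡.cong (λ n → fromℕ n * f j) |P|≡|Q| ⟨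
    fromℕ (count P) * f j          ≈⟨ sumF-ind-const P (f j) ⟨
    sumF (λ i → ind (P i) (f j))   ≤⟨ sumF-mono-≤ (λ i → ind-mono-≤ (P i) (min i)) ⟩
    sumF (λ i → ind (P i) (f i))   ∎
    where open ≤-Reasoning

  module Bilinear {s : ℕ} where

    Vector : Set a
    Vector = Fin s → Carrier

    bilinear : (Fin s → Fin s → Carrier) → Vector → Vector → Carrier
    bilinear f x y = sumF (λ α → sumF (λ β → (x α * y β) * f α β))

    pointMass : Fin s → Vector
    pointMass γ α = if does (α ≟ γ) then 1# else 0#

    pointMass-nonneg : ∀ γ α → 0# ≤ pointMass γ α
    pointMass-nonneg γ α with α ≟ γ
    ... | yes _ = 0≤1
    ... | no  _ = ≤-refl

    sumF-pointMass : ∀ γ (g : Vector) → sumF (λ α → pointMass γ α * g α) ≈ g γ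
    sumF-pointMass γ g = trans (sumF-single {s} _ γ off) on
      where
      off : ∀ α → α ≢ γ → pointMass γ α * g α ≈ 0#
      off α α≢γ with α ≟ γ
      ... | yes α≡γ = contradiction α≡γ α≢γ
      ... | no  _   = zeroˡ _
      on : pointMass γ γ * g γ ≈ g γ
      on with γ ≟ γ
      ... | yes _   = *-identityˡ _
      ... | no  γ≢γ = contradiction ≡.refl γ≢γ

    bilinear-cong : ∀ f {x x′ y y′} → (∀ α → x α ≈ x′ α) → (∀ β → y β ≈ y′ β) →
                    bilinear f x y ≈ bilinear f x′ y′
    bilinear-cong f x≈x′ y≈y′ = sumF-cong {s} λ α → sumF-cong {s} λ β → *-congʳ (*-cong (x≈x′ α) (y≈y′ β))

    bilinear-nonneg : ∀ {f x y} → (∀ α β → 0# ≤ f α β) → (∀ α → 0# ≤ x α) → (∀ β → 0# ≤ y β) →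
                      0# ≤ bilinear f x y
    bilinear-nonneg 0≤f 0≤x 0≤y =
      sumF-nonneg {s} λ α → sumF-nonneg {s} λ β → *-nonneg (*-nonneg (0≤x α) (0≤y β)) (0≤f α β)

    bilinear-≤-scaled : ∀ {f x y x₀ y₀} a b → (∀ α β → 0# ≤ f α β) → (∀ α → 0# ≤ x α) → (∀ β → 0# ≤ y β) →
                        (∀ α → x α ≤ a * x₀ α) → (∀ β → y β ≤ b * y₀ β) →
                        bilinear f x y ≤ (a * b) * bilinear f x₀ y₀
    bilinear-≤-scaled {f} {x} {y} {x₀} {y₀} a b 0≤f 0≤x 0≤y x≤ax₀ y≤by₀ =
      ≤-respʳ-≈ (trans (sumF-cong {s} λ α → *-distribˡ-sumF {s} (a * b) _) (*-distribˡ-sumF {s} (a * b) _))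
        (sumF-mono-≤ {s} λ α → sumF-mono-≤ {s} λ β → ≤-respʳ-≈ (regroup α β)
          (*-monoʳ-≤-nonneg (f α β) (0≤f α β) (*-mono-≤-nonneg (0≤x α) (0≤y β) (x≤ax₀ α) (y≤by₀ β))))
      where
      regroup : ∀ α β → ((a * x₀ α) * (b * y₀ β)) * f α β ≈ (a * b) * ((x₀ α * y₀ β) * f α β)
      regroup α β = trans (*-congʳ (*-interchange a (x₀ α) b (y₀ β))) (*-assoc _ _ _)

    bilinear-linearˡ : ∀ f x y → bilinear f x y ≈ sumF (λ γ → x γ * bilinear f (pointMass γ) y)
    bilinear-linearˡ f x y = sym (trans (sumF-cong {s} λ γ → *-congˡ (row γ))
      (sumF-cong {s} λ γ → trans (sym (*-distribˡ-sumF {s} (x γ) _)) (sumF-cong {s} λ β → sym (*-assoc _ _ _))))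
      where
      row : ∀ γ → bilinear f (pointMass γ) y ≈ sumF (λ β → y β * f γ β)
      row γ = trans (sumF-cong {s} λ α → trans (sumF-cong {s} λ β → *-assoc _ _ _) (*-distribˡ-sumF {s} (pointMass γ α) _))
                    (sumF-pointMass γ (λ α → sumF (λ β → y β * f α β)))

    bilinear-linearʳ : ∀ f x y → bilinear f x y ≈ sumF (λ γ → y γ * bilinear f x (pointMass γ))
    bilinear-linearʳ f x y = sym (trans (sumF-cong {s} λ γ → *-congˡ (column γ))
      (trans (sumF-cong {s} λ γ → sym (*-distribˡ-sumF {s} (y γ) _))
      (trans (sumF-comm λ γ α → y γ * (x α * f α γ))
      (sumF-cong {s} λ α → sumF-cong {s} λ γ → trans (*-leftComm _ _ _) (sym (*-assoc _ _ _))))))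
      where
      column : ∀ γ → bilinear f x (pointMass γ) ≈ sumF (λ α → x α * f α γ)
      column γ = sumF-cong {s} λ α → trans (sumF-cong {s} λ β → trans (*-congʳ (*-comm _ _)) (*-assoc _ _ _))
                                       (sumF-pointMass γ (λ β → x α * f α β))

  module Graph {n m s : ℕ} (ends : Fin m → Fin n × Fin n)
               (loopless : ∀ e → proj₁ (ends e) ≢ proj₂ (ends e)) where

    open Bilinear {s}

    end₁ end₂ : Fin m → Fin n
    end₁ e = proj₁ (ends e)
    end₂ e = proj₂ (ends e)

    _EndpointOf_ : Fin n → Fin m → Set
    v EndpointOf e = end₁ e ≡ v ⊎ end₂ e ≡ v

    incident⇒EndpointOf : ∀ {e v} → incident ends e v ≡ true → v EndpointOf e
    incident⇒EndpointOf {e} {v} incident≡true with end₁ e ≟ v | end₂ e ≟ v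
    ... | yes end₁≡v | _         = inj₁ end₁≡v
    ... | no  _      | yes end₂≡v = inj₂ end₂≡v

    EndpointOf⇒incident : ∀ {e v} → v EndpointOf e → incident ends e v ≡ true
    EndpointOf⇒incident {e} {v} v∈e with end₁ e ≟ v | end₂ e ≟ v | v∈e
    ... | yes _ | _     | _               = ≡.refl
    ... | no  _ | yes _ | _               = ≡.refl
    ... | no  end₁≢v | no _ | inj₁ end₁≡v = contradiction end₁≡v end₁≢v
    ... | no  _ | no end₂≢v | inj₂ end₂≡v = contradiction end₂≡v end₂≢v

    sumF-incident : ∀ e x → sumF (λ v → ind (incident ends e v) x) ≈ two * x
    sumF-incident e x = begin
      sumF (λ v → ind (incident ends e v) x)                         ≈⟨ sumF-cong {n} split ⟩
      sumF (λ v → ind (does (end₁ e ≟ v)) x + ind (does (end₂ e ≟ v)) x)  ≈⟨ sumF-distrib-+ {n} _ _ ⟩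
      sumF (λ v → ind (does (end₁ e ≟ v)) x) + sumF (λ v → ind (does (end₂ e ≟ v)) x)
                                                                     ≈⟨ +-cong (at (end₁ e)) (at (end₂ e)) ⟩
      x + x                                                          ≈⟨ solve 1 (λ x → x :+ x := con (+ 2) :* x) refl x ⟩
      two * x                                                        ∎
      where
      open ≈-Reasoning setoid
      split : ∀ v → ind (incident ends e v) x ≈ ind (does (end₁ e ≟ v)) x + ind (does (end₂ e ≟ v)) x
      split v with end₁ e ≟ v | end₂ e ≟ v
      ... | yes end₁≡v | yes end₂≡v = contradiction (≡.trans end₁≡v (≡.sym end₂≡v)) (loopless e)
      ... | yes _      | no  _      = sym (+-identityʳ x)
      ... | no  _      | yes _      = sym (+-identityˡ x)
      ... | no  _      | no  _      = sym (+-identityʳ 0#)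
      at : ∀ a → sumF (λ v → ind (does (a ≟ v)) x) ≈ x
      at a = trans (sumF-single {n} _ a off) on
        where
        off : ∀ v → v ≢ a → ind (does (a ≟ v)) x ≈ 0#
        off v v≢a with a ≟ v
        ... | yes a≡v = contradiction (≡.sym a≡v) v≢a
        ... | no  _   = refl
        on : ind (does (a ≟ a)) x ≈ x
        on with a ≟ a
        ... | yes _   = refl
        ... | no  a≢a = contradiction ≡.refl a≢a

    pointAt-self : ∀ (Λ : FracAssign n s) v α β → pointAt Λ v α v β ≡ pointMass α β
    pointAt-self Λ v α β with v ≟ v
    ... | yes _   = ≡.refl
    ... | no  v≢v = contradiction ≡.refl v≢v

    pointAt-other : ∀ (Λ : FracAssign n s) v α w β → w ≢ v → pointAt Λ v α w β ≡ Λ w β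
    pointAt-other Λ v α w β w≢v with w ≟ v
    ... | yes w≡v = contradiction w≡v w≢v
    ... | no  _   = ≡.refl

    edgeVal-cong : ∀ f {Λ Λ′ : FracAssign n s} e →
                   (∀ α → Λ (end₁ e) α ≈ Λ′ (end₁ e) α) → (∀ β → Λ (end₂ e) β ≈ Λ′ (end₂ e) β) →
                   edgeVal ends f Λ e ≈ edgeVal ends f Λ′ e
    edgeVal-cong f e = bilinear-cong (f e)

    edgeVal-expand : ∀ f (Λ : FracAssign n s) e v → v EndpointOf e →
                     edgeVal ends f Λ e ≈ sumF (λ α → Λ v α * edgeVal ends f (pointAt Λ v α) e)
    edgeVal-expand f Λ e .(end₁ e) (inj₁ ≡.refl) =
      trans (bilinear-linearˡ (f e) (Λ (end₁ e)) (Λ (end₂ e))) (sumF-cong λ α → *-congˡ (sym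
        (bilinear-cong (f e) (λ β → reflexive (pointAt-self Λ (end₁ e) α β))
                             (λ β → reflexive (pointAt-other Λ (end₁ e) α (end₂ e) β (loopless e ∘ ≡.sym))))))
    edgeVal-expand f Λ e .(end₂ e) (inj₂ ≡.refl) =
      trans (bilinear-linearʳ (f e) (Λ (end₁ e)) (Λ (end₂ e))) (sumF-cong λ α → *-congˡ (sym
        (bilinear-cong (f e) (λ β → reflexive (pointAt-other Λ (end₂ e) α (end₁ e) β (loopless e)))
                             (λ β → reflexive (pointAt-self Λ (end₂ e) α β)))))

  module BasicRoundingStep {n m s p : ℕ} (ends : Fin m → Fin n × Fin n) (loopless : ∀ e → proj₁ (ends e) ≢ proj₂ (ends e))
    (u c : Fin m → Fin s → Fin s → Carrier) (u-nonneg : ∀ e α β → 0# ≤ u e α β) (c-nonneg : ∀ e α β → 0# ≤ c e α β)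
    (κ : Carrier) (κ-nonneg : 0# ≤ κ) (δ η sixth : Carrier) (δ-nonneg : 0# ≤ δ) (η-nonneg : 0# ≤ η)
    (sixth*6≈1 : sixth * fromℕ 6 ≈ 1#) (φ : Fin n → Fin p) where

    open Bilinear {s}
    open Graph {s = s} ends loopless
    open Rounding.Step F ends u c κ δ η sixth φ
    open import Data.List.Membership.DecPropositional {A = Fin p} _≟_ using (_∈_; _∉_; _∈?_)

    δ/6 : Carrier
    δ/6 = δ * sixth

    sixth-nonneg : 0# ≤ sixth
    sixth-nonneg = 0≤x*y≈1⇒0≤x (fromℕ-nonneg 6) sixth*6≈1

    δ/6-nonneg : 0# ≤ δ/6
    δ/6-nonneg = *-nonneg δ-nonneg sixth-nonneg

    objective weight : FracAssign n s → Fin m → Carrier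
    objective Λ e = edgeVal ends u Λ e - η * edgeVal ends c Λ e
    weight    Λ e = edgeVal ends u Λ e + η * edgeVal ends c Λ e

    values-nonneg : ∀ (M : NumAssign n s) v α → 0# ≤ values κ M v α
    values-nonneg M v α = *-nonneg κ-nonneg (fromℕ-nonneg (M v α))

    pointAt-nonneg : ∀ (M : NumAssign n s) v α w β → 0# ≤ pointAt (values κ M) v α w β
    pointAt-nonneg M v α w β with w ≟ v
    ... | yes _ = pointMass-nonneg α β
    ... | no  _ = values-nonneg M w β

    weight-nonneg : ∀ (Λ : FracAssign n s) → (∀ v α → 0# ≤ Λ v α) → ∀ e → 0# ≤ weight Λ e
    weight-nonneg Λ Λ-nonneg e = +-nonneg (edge-nonneg u u-nonneg) (*-nonneg η-nonneg (edge-nonneg c c-nonneg))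
      where
      edge-nonneg : ∀ f → (∀ e α β → 0# ≤ f e α β) → 0# ≤ edgeVal ends f Λ e
      edge-nonneg f f-nonneg = bilinear-nonneg (f-nonneg e) (Λ-nonneg (end₁ e)) (Λ-nonneg (end₂ e))

    objective-cong : ∀ {Λ Λ′ : FracAssign n s} e →
                     (∀ α → Λ (end₁ e) α ≈ Λ′ (end₁ e) α) → (∀ β → Λ (end₂ e) β ≈ Λ′ (end₂ e) β) →
                     objective Λ e ≈ objective Λ′ e
    objective-cong {Λ} {Λ′} e Λ≈Λ′₁ Λ≈Λ′₂ =
      +-cong (edgeVal-cong u {Λ} {Λ′} e Λ≈Λ′₁ Λ≈Λ′₂) (-‿cong (*-congˡ (edgeVal-cong c {Λ} {Λ′} e Λ≈Λ′₁ Λ≈Λ′₂)))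

    weight-≤-scaled : ∀ (Λ Λ′ : FracAssign n s) e x y → (∀ v α → 0# ≤ Λ v α) →
                      (∀ α → Λ (end₁ e) α ≤ x * Λ′ (end₁ e) α) → (∀ β → Λ (end₂ e) β ≤ y * Λ′ (end₂ e) β) →
                      weight Λ e ≤ (x * y) * weight Λ′ e
    weight-≤-scaled Λ Λ′ e x y Λ-nonneg Λ≤₁ Λ≤₂ = ≤-respʳ-≈ (sym (distribˡ (x * y) _ _))
      (+-mono-≤ (scaled u u-nonneg)
                (≤-respʳ-≈ (*-leftComm η (x * y) _) (*-monoˡ-≤-nonneg η η-nonneg (scaled c c-nonneg))))
      where
      scaled : ∀ f → (∀ e α β → 0# ≤ f e α β) → edgeVal ends f Λ e ≤ (x * y) * edgeVal ends f Λ′ e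
      scaled f f-nonneg = bilinear-≤-scaled x y (f-nonneg e) (Λ-nonneg (end₁ e)) (Λ-nonneg (end₂ e)) Λ≤₁ Λ≤₂

    sumF-*-combine-sub : ∀ {k} (x U C : Fin k → Carrier) →
                       sumF (λ α → x α * (U α - η * C α)) ≈ sumF (λ α → x α * U α) - η * sumF (λ α → x α * C α)
    sumF-*-combine-sub {k} x U C = trans (sumF-cong λ α → expand α)
      (trans (sumF-distrib-sub {k} _ _) (+-congˡ (-‿cong (*-distribˡ-sumF {k} η _))))
      where
      expand : ∀ α → x α * (U α - η * C α) ≈ x α * U α - η * (x α * C α)
      expand α = solve 4 (λ x U C η → x :* (U :- η :* C) := x :* U :- η :* (x :* C)) refl (x α) (U α) (C α) η

    sumF-*-combine-add : ∀ {k} (x U C : Fin k → Carrier) →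
                       sumF (λ α → x α * (U α + η * C α)) ≈ sumF (λ α → x α * U α) + η * sumF (λ α → x α * C α)
    sumF-*-combine-add {k} x U C = trans (sumF-cong λ α → expand α)
      (trans (sumF-distrib-+ {k} _ _) (+-congˡ (*-distribˡ-sumF {k} η _)))
      where
      expand : ∀ α → x α * (U α + η * C α) ≈ x α * U α + η * (x α * C α)
      expand α = solve 4 (λ x U C η → x :* (U :+ η :* C) := x :* U :+ η :* (x :* C)) refl (x α) (U α) (C α) η

    objective-expand : ∀ (Λ : FracAssign n s) e v → v EndpointOf e →
                       objective Λ e ≈ sumF (λ α → Λ v α * objective (pointAt Λ v α) e)
    objective-expand Λ e v v∈e = sym (trans (sumF-*-combine-sub {s} (Λ v) _ _)
      (+-cong (sym (edgeVal-expand u Λ e v v∈e)) (-‿cong (*-congˡ (sym (edgeVal-expand c Λ e v v∈e))))))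

    weight-expand : ∀ (Λ : FracAssign n s) e v → v EndpointOf e →
                    weight Λ e ≈ sumF (λ α → Λ v α * weight (pointAt Λ v α) e)
    weight-expand Λ e v v∈e = sym (trans (sumF-*-combine-add {s} (Λ v) _ _)
      (+-cong (sym (edgeVal-expand u Λ e v v∈e)) (*-congˡ (sym (edgeVal-expand c Λ e v v∈e)))))

    monochromatic : Fin m → Bool
    monochromatic e = does (φ (end₁ e) ≟ φ (end₂ e))

    does-≟⇒≡ : ∀ {k} {i j : Fin k} → does (i ≟ j) ≡ true → i ≡ j
    does-≟⇒≡ {i = i} {j} does≡true with i ≟ j
    ... | yes i≡j = i≡j

    Eb⇒ : ∀ {v e} → Eb v e ≡ true → v EndpointOf e × φ (end₁ e) ≢ φ (end₂ e)
    Eb⇒ {v} {e} Eb≡true with incident ends e v in incident≡true | φ (end₁ e) ≟ φ (end₂ e)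
    ... | true | no φ≢φ = incident⇒EndpointOf incident≡true , φ≢φ

    ⇒Eb : ∀ {v e} → v EndpointOf e → φ (end₁ e) ≢ φ (end₂ e) → Eb v e ≡ true
    ⇒Eb {v} {e} v∈e φ≢φ rewrite EndpointOf⇒incident v∈e | dec-false (φ (end₁ e) ≟ φ (end₂ e)) φ≢φ = ≡.refl

    sumF-ind-expand : (b : Fin m → Bool) (x : Fin m → Carrier) (z : Fin s → Carrier) (y : Fin s → Fin m → Carrier) →
                      (∀ e → b e ≡ true → x e ≈ sumF (λ α → z α * y α e)) →
                      sumF (λ e → ind (b e) (x e)) ≈ sumF (λ α → z α * sumF (λ e → ind (b e) (y α e)))
    sumF-ind-expand b x z y x≈ = begin
      sumF (λ e → ind (b e) (x e))                            ≈⟨ sumF-cong {m} (λ e → expand (b e) (x e) (λ α → y α e) (x≈ e)) ⟩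
      sumF (λ e → sumF (λ α → z α * ind (b e) (y α e)))       ≈⟨ sumF-comm {m} {s} _ ⟩
      sumF (λ α → sumF (λ e → z α * ind (b e) (y α e)))       ≈⟨ sumF-cong {s} (λ α → *-distribˡ-sumF {m} (z α) _) ⟩
      sumF (λ α → z α * sumF (λ e → ind (b e) (y α e)))       ∎
      where
      open ≈-Reasoning setoid
      expand : ∀ b x (y : Fin s → Carrier) → (b ≡ true → x ≈ sumF (λ α → z α * y α)) →
               ind b x ≈ sumF (λ α → z α * ind b (y α))
      expand true  x y x≈ = x≈ ≡.refl
      expand false x y x≈ = sym (sumF-zero {s} λ α → zeroʳ (z α))

    phiVal-sumF : ∀ M v α → sumF (λ e → ind (Eb v e) (objective (pointAt (values κ M) v α) e)) ≈ phiVal M v α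
    phiVal-sumF M v α = trans (sumF-cong {m} λ e → trans (ind-distrib-sub (Eb v e) _ _) (+-congˡ (-‿cong (ind-*ˡ (Eb v e) η _))))
      (trans (sumF-distrib-sub {m} _ _) (+-congˡ (-‿cong (*-distribˡ-sumF {m} η _))))

    thetaVal-sumF : ∀ M v α → sumF (λ e → ind (Eb v e) (weight (pointAt (values κ M) v α) e)) ≈ thetaVal M v α
    thetaVal-sumF M v α = trans (sumF-cong {m} λ e → trans (ind-distrib-+ (Eb v e) _ _) (+-congˡ (ind-*ˡ (Eb v e) η _)))
      (trans (sumF-distrib-+ {m} _ _) (+-congˡ (*-distribˡ-sumF {m} η _)))

    thetaVal-nonneg : ∀ M v α → 0# ≤ thetaVal M v α
    thetaVal-nonneg M v α = ≤-respʳ-≈ (thetaVal-sumF M v α)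
      (sumF-nonneg {m} λ e → ind-nonneg (Eb v e) λ _ → weight-nonneg _ (pointAt-nonneg M v α) e)

    bichromatic-weight : ∀ M v →
      sumF (λ e → ind (Eb v e) (weight (values κ M) e)) ≈ sumF (λ α → values κ M v α * thetaVal M v α)
    bichromatic-weight M v =
      trans (sumF-ind-expand (Eb v) _ (values κ M v) (λ α → weight (pointAt (values κ M) v α))
                             (λ e Eb≡true → weight-expand (values κ M) e v (proj₁ (Eb⇒ Eb≡true))))
            (sumF-cong {s} λ α → *-congˡ (thetaVal-sumF M v α))

    -- Only v changes on its bichromatic edges, and the objective is linear in the labels of v.
    bichromatic-objective-change : ∀ M M₁ v →
      (∀ e → Eb v e ≡ true → ∀ w → w ≢ v → w EndpointOf e → ∀ β → values κ M₁ w β ≈ values κ M w β) →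
      sumF (λ e → ind (Eb v e) (objective (values κ M₁) e - objective (values κ M) e))
        ≈ sumF (λ α → (values κ M₁ v α - values κ M v α) * phiVal M v α)
    bichromatic-objective-change M M₁ v unchanged =
      trans (sumF-ind-expand (Eb v) _ (λ α → Λ₁ v α - Λ v α) (λ α → objective (pointAt Λ v α)) change)
            (sumF-cong {s} λ α → *-congˡ (phiVal-sumF M v α))
      where
      Λ Λ₁ : FracAssign n s
      Λ  = values κ M
      Λ₁ = values κ M₁
      change : ∀ e → Eb v e ≡ true →
               objective Λ₁ e - objective Λ e ≈ sumF (λ α → (Λ₁ v α - Λ v α) * objective (pointAt Λ v α) e)
      change e Eb≡true = begin
        objective Λ₁ e - objective Λ e
          ≈⟨ +-cong (objective-expand Λ₁ e v v∈e) (-‿cong (objective-expand Λ e v v∈e)) ⟩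
        sumF (λ α → Λ₁ v α * objective (pointAt Λ₁ v α) e) - sumF (λ α → Λ v α * objective (pointAt Λ v α) e)
          ≈⟨ +-congʳ (sumF-cong {s} λ α → *-congˡ (objective-cong {pointAt Λ₁ v α} {pointAt Λ v α} e
                                                     (agree α (end₁ e) (inj₁ ≡.refl)) (agree α (end₂ e) (inj₂ ≡.refl)))) ⟩
        sumF (λ α → Λ₁ v α * objective (pointAt Λ v α) e) - sumF (λ α → Λ v α * objective (pointAt Λ v α) e)
          ≈⟨ sumF-distrib-sub {s} _ _ ⟨
        sumF (λ α → Λ₁ v α * objective (pointAt Λ v α) e - Λ v α * objective (pointAt Λ v α) e)
          ≈⟨ sumF-cong {s} (λ α → solve 3 (λ x y z → x :* z :- y :* z := (x :- y) :* z) refl _ _ _) ⟩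
        sumF (λ α → (Λ₁ v α - Λ v α) * objective (pointAt Λ v α) e)  ∎
        where
        open ≈-Reasoning setoid
        v∈e : v EndpointOf e
        v∈e = proj₁ (Eb⇒ Eb≡true)
        agree : ∀ α w → w EndpointOf e → ∀ β → pointAt Λ₁ v α w β ≈ pointAt Λ v α w β
        agree α w w∈e β with w ≟ v
        ... | yes _   = refl
        ... | no  w≢v = unchanged e Eb≡true w w≢v w∈e β

    κ-row-change : ∀ {odd plus r x} → RowStep odd plus r x →
                   κ * fromℕ r - κ * fromℕ x ≈ ind (odd ∧ plus) κ - ind (odd ∧ not plus) κ
    κ-row-change {x = x} (inj₁ (≡.refl , ≡.refl , ≡.refl)) =
      solve 2 (λ κ x → κ :* (con (+ 1) :+ x) :- κ :* x := κ :- con (+ 0)) refl κ (fromℕ x)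
    κ-row-change {r = r} (inj₂ (inj₁ (≡.refl , ≡.refl , ≡.refl))) =
      solve 2 (λ κ r → κ :* r :- κ :* (con (+ 1) :+ r) := con (+ 0) :- κ) refl κ (fromℕ r)
    κ-row-change {r = r} (inj₂ (inj₂ (≡.refl , ≡.refl))) =
      solve 2 (λ κ r → κ :* r :- κ :* r := con (+ 0) :- con (+ 0)) refl κ (fromℕ r)

    ind-*-swap : ∀ b x y → ind b x * y ≈ x * ind b y
    ind-*-swap true  x y = refl
    ind-*-swap false x y = trans (zeroˡ y) (sym (zeroʳ x))

    odd⇒κ≤κ*x : ∀ x → isOdd x ≡ true → κ ≤ κ * fromℕ x
    odd⇒κ≤κ*x (suc x) _ = ≤-respˡ-≈ (*-identityʳ κ)
      (*-monoˡ-≤-nonneg κ κ-nonneg (≤-respˡ-≈ (+-identityʳ 1#) (+-monoʳ-≤ 1# (fromℕ-nonneg x))))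

    rounding-arithmetic : ∀ {A B X⁺ X⁻ T Z} → B ≤ A → A ≤ X⁺ → X⁻ ≤ B + δ/6 * T → κ * T ≤ Z →
                          0# ≤ κ * (X⁺ - X⁻) + δ/6 * Z
    rounding-arithmetic {A} {B} {X⁺} {X⁻} {T} {Z} B≤A A≤X⁺ X⁻≤ κT≤Z = begin
      0#                                         ≤⟨ *-nonneg κ-nonneg (x≤y⇒0≤y-x B≤A) ⟩
      κ * (A - B)                                ≈⟨ solve 5 (λ κ d A B T → κ :* (A :- (B :+ d :* T)) :+ d :* (κ :* T) := κ :* (A :- B))
                                                          refl κ δ/6 A B T ⟨
      κ * (A - (B + δ/6 * T)) + δ/6 * (κ * T)    ≤⟨ +-mono-≤ (*-monoˡ-≤-nonneg κ κ-nonneg (+-mono-≤ A≤X⁺ (-‿antimono-≤ X⁻≤)))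
                                                             (*-monoˡ-≤-nonneg δ/6 δ/6-nonneg κT≤Z) ⟩
      κ * (X⁺ - X⁻) + δ/6 * Z                    ∎
      where open ≤-Reasoning

    -- Σ⁺ gains κ ϕ and Σ⁻ loses κ ϕ; the estimates favour Σ⁺ and are (δ/6) θ-accurate, and on
    -- a label of Σ⁻ the current value is at least κ because its numerator is odd.
    rounding-gain : ∀ M v row → NodeUpdate M v row →
      0# ≤ sumF (λ α → (κ * fromℕ (row α) - values κ M v α) * phiVal M v α)
           + δ/6 * sumF (λ α → values κ M v α * thetaVal M v α)
    rounding-gain M v row upd =
      ≤-respʳ-≈ (+-congʳ (sym change≈)) (rounding-arithmetic Σ⁻hat≤Σ⁺hat Σ⁺hat≤Σ⁺ϕ Σ⁻ϕ≤Σ⁻hat+δ/6Σ⁻θ κΣ⁻θ≤ΣΛθ)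
      where
      open NodeUpdate upd
      odd : Fin s → Bool
      odd = inΣ M v
      ϕ θ : Fin s → Carrier
      ϕ = phiVal M v
      θ = thetaVal M v
      Σ⁺ Σ⁻ : Fin s → Bool
      Σ⁺ α = odd α ∧ plus α
      Σ⁻ α = odd α ∧ not (plus α)
      ∑_[_] : (Fin s → Bool) → (Fin s → Carrier) → Carrier
      ∑ P [ f ] = sumF (λ α → ind (P α) (f α))

      change≈ : sumF (λ α → (κ * fromℕ (row α) - values κ M v α) * ϕ α) ≈ κ * (∑ Σ⁺ [ ϕ ] - ∑ Σ⁻ [ ϕ ])
      change≈ = trans (sumF-cong {s} λ α → trans (*-congʳ (κ-row-change (newRow α)))
                        (trans (solve 3 (λ a b x → (a :- b) :* x := a :* x :- b :* x) refl _ _ _)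
                        (trans (+-cong (ind-*-swap (Σ⁺ α) κ _) (-‿cong (ind-*-swap (Σ⁻ α) κ _))) (sym (x[y-z]≈xy-xz κ _ _)))))
                (trans (*-distribˡ-sumF {s} κ _) (*-congˡ (sumF-distrib-sub {s} _ _)))
      Σ⁻hat≤Σ⁺hat : ∑ Σ⁻ [ hat ] ≤ ∑ Σ⁺ [ hat ]
      Σ⁻hat≤Σ⁺hat = sumF-ind-≤-balanced Σ⁺ Σ⁻ hat balanced λ α β α∈Σ⁺ β∈Σ⁻ →
        ordered α β (proj₁ (∧≡true⇒ α∈Σ⁺)) (proj₂ (∧≡true⇒ α∈Σ⁺))
                    (proj₁ (∧≡true⇒ β∈Σ⁻)) (not≡true⇒ (proj₂ (∧≡true⇒ β∈Σ⁻)))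
      Σ⁺hat≤Σ⁺ϕ : ∑ Σ⁺ [ hat ] ≤ ∑ Σ⁺ [ ϕ ]
      Σ⁺hat≤Σ⁺ϕ = sumF-mono-≤ {s} λ α → ind-mono-≤ (Σ⁺ α) (hat-up α ∘ proj₁ ∘ ∧≡true⇒)
      Σ⁻ϕ≤Σ⁻hat+δ/6Σ⁻θ : ∑ Σ⁻ [ ϕ ] ≤ ∑ Σ⁻ [ hat ] + δ/6 * ∑ Σ⁻ [ θ ]
      Σ⁻ϕ≤Σ⁻hat+δ/6Σ⁻θ = ≤-respʳ-≈ (trans (sumF-cong {s} λ α → trans (ind-distrib-+ (Σ⁻ α) _ _) (+-congˡ (ind-*ˡ (Σ⁻ α) δ/6 _)))
                                           (trans (sumF-distrib-+ {s} _ _) (+-congˡ (*-distribˡ-sumF {s} δ/6 _))))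
        (sumF-mono-≤ {s} λ α → ind-mono-≤ (Σ⁻ α) λ α∈Σ⁻ → ≤-respˡ-≈ (solve 2 (λ x y → x :- y :+ y := x) refl (ϕ α) (δ/6 * θ α))
                                                           (+-monoˡ-≤ (δ/6 * θ α) (hat-low α (proj₁ (∧≡true⇒ α∈Σ⁻)))))
      κΣ⁻θ≤ΣΛθ : κ * ∑ Σ⁻ [ θ ] ≤ sumF (λ α → values κ M v α * θ α)
      κΣ⁻θ≤ΣΛθ = ≤-respˡ-≈ (*-distribˡ-sumF {s} κ _) (sumF-mono-≤ {s} λ α → bound α (Σ⁻ α) ≡.refl)
        where
        bound : ∀ α b → b ≡ Σ⁻ α → κ * ind b (θ α) ≤ values κ M v α * θ α
        bound α true  b≡ =
          *-monoʳ-≤-nonneg (θ α) (thetaVal-nonneg M v α) (odd⇒κ≤κ*x (M v α) (proj₁ (∧≡true⇒ (≡.sym b≡))))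
        bound α false _  = ≤-respˡ-≈ (sym (zeroʳ κ)) (*-nonneg (values-nonneg M v α) (thetaVal-nonneg M v α))

    bichromatic-other-colour : ∀ {v w e} → v EndpointOf e → w EndpointOf e → w ≢ v →
                               φ (end₁ e) ≢ φ (end₂ e) → φ w ≢ φ v
    bichromatic-other-colour (inj₁ ≡.refl) (inj₁ ≡.refl) w≢v _     = contradiction ≡.refl w≢v
    bichromatic-other-colour (inj₁ ≡.refl) (inj₂ ≡.refl) _   φ₁≢φ₂ = φ₁≢φ₂ ∘ ≡.sym
    bichromatic-other-colour (inj₂ ≡.refl) (inj₁ ≡.refl) _   φ₁≢φ₂ = φ₁≢φ₂
    bichromatic-other-colour (inj₂ ≡.refl) (inj₂ ≡.refl) w≢v _     = contradiction ≡.refl w≢v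

    -- An edge with an endpoint of colour γ either has both endpoints of colour γ, or it is a
    -- bichromatic edge of exactly one node of colour γ.
    phase-split : ∀ γ (T : Fin m → Carrier) → (∀ e → φ (end₁ e) ≢ γ → φ (end₂ e) ≢ γ → T e ≈ 0#) →
      sumF T ≈ sumF (λ e → ind (does (φ (end₁ e) ≟ γ) ∧ does (φ (end₂ e) ≟ γ)) (T e))
             + sumF (λ v → ind (does (φ v ≟ γ)) (sumF (λ e → ind (Eb v e) (T e))))
    phase-split γ T T≈0 =
      trans (sumF-cong {m} per-edge)
        (trans (sumF-distrib-+ {m} _ _)
          (+-congˡ (trans (sumF-comm {m} {n} λ e v → ind (does (φ v ≟ γ)) (ind (Eb v e) (T e)))
                          (sumF-cong {n} λ v → sym (ind-sumF {m} (does (φ v ≟ γ)) λ e → ind (Eb v e) (T e))))))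
      where
      only-at : ∀ e w → φ w ≡ γ → Eb w e ≡ true → (∀ v → φ v ≡ γ → Eb v e ≡ true → v ≡ w) →
                sumF (λ v → ind (does (φ v ≟ γ)) (ind (Eb v e) (T e))) ≈ T e
      only-at e w φw≡γ Ebw≡true unique = trans (sumF-single {n} _ w off) on
        where
        on : ind (does (φ w ≟ γ)) (ind (Eb w e) (T e)) ≈ T e
        on rewrite dec-true (φ w ≟ γ) φw≡γ | Ebw≡true = refl
        off : ∀ v → v ≢ w → ind (does (φ v ≟ γ)) (ind (Eb v e) (T e)) ≈ 0#
        off v v≢w with φ v ≟ γ
        ... | no  _    = refl
        ... | yes φv≡γ = ind-zero (Eb v e) λ Ebv≡true → contradiction (unique v φv≡γ Ebv≡true) v≢w
      per-edge : ∀ e → T e ≈ ind (does (φ (end₁ e) ≟ γ) ∧ does (φ (end₂ e) ≟ γ)) (T e)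
                             + sumF (λ v → ind (does (φ v ≟ γ)) (ind (Eb v e) (T e)))
      per-edge e with φ (end₁ e) ≟ γ | φ (end₂ e) ≟ γ
      ... | yes φ₁≡γ | yes φ₂≡γ = sym (trans (+-congˡ (sumF-zero {n} λ v → ind-zero (does (φ v ≟ γ)) λ _ →
              ind-zero (Eb v e) λ Eb≡true → contradiction (≡.trans φ₁≡γ (≡.sym φ₂≡γ)) (proj₂ (Eb⇒ Eb≡true))))
            (+-identityʳ _))
      ... | yes φ₁≡γ | no  φ₂≢γ = sym (trans (+-identityˡ _) (only-at e (end₁ e) φ₁≡γ
            (⇒Eb (inj₁ ≡.refl) λ φ₁≡φ₂ → φ₂≢γ (≡.trans (≡.sym φ₁≡φ₂) φ₁≡γ))
            λ v φv≡γ Eb≡true → [ ≡.sym , (λ end₂≡v → contradiction (≡.trans (≡.cong φ end₂≡v) φv≡γ) φ₂≢γ) ]′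
                                 (proj₁ (Eb⇒ Eb≡true))))
      ... | no  φ₁≢γ | yes φ₂≡γ = sym (trans (+-identityˡ _) (only-at e (end₂ e) φ₂≡γ
            (⇒Eb (inj₂ ≡.refl) λ φ₁≡φ₂ → φ₁≢γ (≡.trans φ₁≡φ₂ φ₂≡γ))
            λ v φv≡γ Eb≡true → [ (λ end₁≡v → contradiction (≡.trans (≡.cong φ end₁≡v) φv≡γ) φ₁≢γ) , ≡.sym ]′
                                 (proj₁ (Eb⇒ Eb≡true))))
      ... | no  φ₁≢γ | no  φ₂≢γ = trans (T≈0 e φ₁≢γ φ₂≢γ) (sym (trans (+-identityˡ _)
            (sumF-zero {n} λ v → ind-zero (does (φ v ≟ γ)) λ _ → ind-zero (Eb v e) λ _ → T≈0 e φ₁≢γ φ₂≢γ)))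

    values-≤-double : ∀ {r x} → r ℕ.≤ 2 ℕ.* x → κ * fromℕ r ≤ two * (κ * fromℕ x)
    values-≤-double {r} {x} r≤2x = ≤-respʳ-≈ κ*2x≈ (*-monoˡ-≤-nonneg κ κ-nonneg (fromℕ-mono-≤ r≤2x))
      where
      κ*2x≈ : κ * fromℕ (2 ℕ.* x) ≈ two * (κ * fromℕ x)
      κ*2x≈ = trans (*-congˡ (trans (fromℕ-* 2 x) (*-congʳ (+-congˡ (+-identityʳ 1#)))))
                    (solve 2 (λ κ x → κ :* (con (+ 2) :* x) := con (+ 2) :* (κ :* x)) refl κ (fromℕ x))

    odd⇒1≤ : ∀ x → isOdd x ≡ true → 1 ℕ.≤ x
    odd⇒1≤ (suc x) _ = ℕ.s≤s ℕ.z≤n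

    node-update-rows : ∀ M v row → NodeUpdate M v row → (∀ α → Even (row α)) × sumℕ row ≡ sumℕ (M v)
    node-update-rows M v row upd = (λ α → RowStep-even (M v α) (newRow α)) , ℕ.+-cancelʳ-≡ _ _ _ (begin
      sumℕ row ℕ.+ count Σ⁻          ≡⟨ sumℕ-distrib-+ row _ ⟨
      sumℕ (λ α → row α ℕ.+ _)       ≡⟨ sumℕ-cong (λ α → RowStep-sum (newRow α)) ⟩
      sumℕ (λ α → M v α ℕ.+ _)       ≡⟨ sumℕ-distrib-+ (M v) _ ⟩
      sumℕ (M v) ℕ.+ count Σ⁺        ≡⟨ ≡.cong (sumℕ (M v) ℕ.+_) balanced ⟩
      sumℕ (M v) ℕ.+ count Σ⁻        ∎)
      where
      open NodeUpdate upd
      open ≡.≡-Reasoning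
      Σ⁺ Σ⁻ : Fin s → Bool
      Σ⁺ α = inΣ M v α ∧ plus α
      Σ⁻ α = inΣ M v α ∧ not (plus α)

    run-rows : ∀ {γs M M′} → Run γs M M′ → Unique γs → ∀ v →
               (φ v ∉ γs → ∀ α → M′ v α ≡ M v α) × (φ v ∈ γs → (∀ α → Even (M′ v α)) × sumℕ (M′ v) ≡ sumℕ (M v))
    run-rows done _ v = (λ _ _ → ≡.refl) , λ ()
    run-rows {γ ∷ γs} {M} {M′} (step {N₁ = M₁} phase run) (γ∉γs ∷ unique) v = unvisited , visited
      where
      open Phase phase
      later : (φ v ∉ γs → ∀ α → M′ v α ≡ M₁ v α) × (φ v ∈ γs → (∀ α → Even (M′ v α)) × sumℕ (M′ v) ≡ sumℕ (M₁ v))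
      later = run-rows run unique v
      not-γ : φ v ∈ γs → φ v ≢ γ
      not-γ φv∈γs φv≡γ = All.lookup γ∉γs φv∈γs (≡.sym φv≡γ)
      unvisited : φ v ∉ γ ∷ γs → ∀ α → M′ v α ≡ M v α
      unvisited φv∉ α = ≡.trans (proj₁ later (φv∉ ∘ there) α) (inactive v (φv∉ ∘ here) α)
      visited : φ v ∈ γ ∷ γs → (∀ α → Even (M′ v α)) × sumℕ (M′ v) ≡ sumℕ (M v)
      visited (here φv≡γ) = (λ α → ≡.subst Even (≡.sym (M′≡M₁ α)) (even α)) , ≡.trans (sumℕ-cong M′≡M₁) sum≡
        where
        M′≡M₁ : ∀ α → M′ v α ≡ M₁ v α
        M′≡M₁ = proj₁ later (λ φv∈γs → not-γ φv∈γs φv≡γ)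
        even : ∀ α → Even (M₁ v α)
        even = proj₁ (node-update-rows M v (M₁ v) (active v φv≡γ))
        sum≡ : sumℕ (M₁ v) ≡ sumℕ (M v)
        sum≡ = proj₂ (node-update-rows M v (M₁ v) (active v φv≡γ))
      visited (there φv∈γs) = proj₁ rows , ≡.trans (proj₂ rows) (sumℕ-cong (inactive v (not-γ φv∈γs)))
        where
        rows : (∀ α → Even (M′ v α)) × sumℕ (M′ v) ≡ sumℕ (M₁ v)
        rows = proj₂ later φv∈γs

    module Potential (N : NumAssign n s) where

      Λ₀ : FracAssign n s
      Λ₀ = values κ N

      w₀ : Fin m → Carrier
      w₀ = weight Λ₀

      value : NumAssign n s → Carrier
      value M = sumF (objective (values κ M))

      growth : Bool → Carrier
      growth false = 1#
      growth true  = two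

      rate : Fin m → Carrier
      rate e = if monochromatic e then 1# else δ/6

      -- Once the endpoints flagged by D have been rounded, the weight of e may have grown by the
      -- factor growth · growth; the charge of e pays for the loss this can cause later.
      charge : (Fin n → Bool) → Fin m → Carrier
      charge D e = rate e * ((growth (D (end₁ e)) * growth (D (end₂ e)) - 1#) * w₀ e)

      charge-≡ : ∀ D e {r g₁ g₂} → rate e ≡ r → growth (D (end₁ e)) ≡ g₁ → growth (D (end₂ e)) ≡ g₂ →
                 charge D e ≡ r * ((g₁ * g₂ - 1#) * w₀ e)
      charge-≡ D e ≡.refl ≡.refl ≡.refl = ≡.refl

      potential : (Fin n → Bool) → Carrier
      potential D = sumF (charge D)

      module _ (γ : Fin p) (M M₁ : NumAssign n s) (phase : Phase γ M M₁) (D D′ : Fin n → Bool)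
               (D-γ : ∀ v → φ v ≡ γ → D v ≡ false) (D′-γ : ∀ v → φ v ≡ γ → D′ v ≡ true)
               (D′-other : ∀ v → φ v ≢ γ → D′ v ≡ D v)
               (M-γ : ∀ v → φ v ≡ γ → ∀ α → M v α ≡ N v α)
               (M-bound : ∀ v α → values κ M v α ≤ growth (D v) * Λ₀ v α) where

        open Phase phase

        Λ Λ₁ : FracAssign n s
        Λ  = values κ M
        Λ₁ = values κ M₁

        Λ-γ : ∀ v → φ v ≡ γ → ∀ α → Λ v α ≈ Λ₀ v α
        Λ-γ v φv≡γ α = reflexive (≡.cong (λ k → κ * fromℕ k) (M-γ v φv≡γ α))

        Λ₁-γ : ∀ v → φ v ≡ γ → ∀ α → Λ₁ v α ≤ two * Λ₀ v α
        Λ₁-γ v φv≡γ α = ≤-respʳ-≈ (*-congˡ (Λ-γ v φv≡γ α))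
          (values-≤-double {x = M v α} (RowStep-≤-double (newRow α) (odd⇒1≤ (M v α))))
          where open NodeUpdate (active v φv≡γ)

        Λ₁-other : ∀ v → φ v ≢ γ → ∀ α → Λ₁ v α ≈ Λ v α
        Λ₁-other v φv≢γ α = reflexive (≡.cong (λ k → κ * fromℕ k) (inactive v φv≢γ α))

        Δobjective : Fin m → Carrier
        Δobjective e = objective Λ₁ e - objective Λ e

        T : Fin m → Carrier
        T e = Δobjective e + (charge D′ e - charge D e)

        T-neither : ∀ e → φ (end₁ e) ≢ γ → φ (end₂ e) ≢ γ → T e ≈ 0#
        T-neither e φ₁≢γ φ₂≢γ rewrite D′-other (end₁ e) φ₁≢γ | D′-other (end₂ e) φ₂≢γ =
          trans (+-cong (trans (+-congʳ (objective-cong {Λ₁} {Λ} e (Λ₁-other _ φ₁≢γ) (Λ₁-other _ φ₂≢γ)))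
                               (-‿inverseʳ _))
                        (-‿inverseʳ _))
                (+-identityʳ 0#)

        -- Before the phase the labels of both endpoints are the original ones, afterwards they are at
        -- most doubled; so the objective drops by at most 4η c + (u - η c), while the charge releases 3 w.
        T-both : ∀ e → φ (end₁ e) ≡ γ → φ (end₂ e) ≡ γ → 0# ≤ T e
        T-both e φ₁≡γ φ₂≡γ = begin
          0#                                ≤⟨ +-nonneg U₀-nonneg U₀-nonneg ⟩
          U₀ + U₀                           ≈⟨ solve 3 (λ η U C → (con (+ 0) :- η :* ((con (+ 2) :* con (+ 2)) :* C)) :- (U :- η :* C)
                                                    :+ (con (+ 1) :* ((con (+ 2) :* con (+ 2) :- con (+ 1)) :* (U :+ η :* C))
                                                       :- con (+ 1) :* ((con (+ 1) :* con (+ 1) :- con (+ 1)) :* (U :+ η :* C)))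
                                                    := U :+ U) refl η U₀ C₀ ⟨
          lower - (U₀ - η * C₀) + Δcharge   ≤⟨ +-monoˡ-≤ Δcharge (+-monoˡ-≤ _ lower≤) ⟩
          objective Λ₁ e - (U₀ - η * C₀) + Δcharge
                                            ≈⟨ +-congʳ (+-congˡ (-‿cong (objective-cong {Λ₀} {Λ} e
                                                 (λ α → sym (Λ-γ _ φ₁≡γ α)) (λ β → sym (Λ-γ _ φ₂≡γ β))))) ⟩
          objective Λ₁ e - objective Λ e + Δcharge
                                            ≡⟨ ≡.cong₂ (λ x y → Δobjective e + (x - y))
                                                 (charge-≡ D′ e rate≡1 (≡.cong growth (D′-γ _ φ₁≡γ)) (≡.cong growth (D′-γ _ φ₂≡γ)))
                                                 (charge-≡ D e rate≡1 (≡.cong growth (D-γ _ φ₁≡γ)) (≡.cong growth (D-γ _ φ₂≡γ))) ⟨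
          T e                               ∎
          where
          open ≤-Reasoning
          U₀ C₀ lower Δcharge : Carrier
          U₀ = edgeVal ends u Λ₀ e
          C₀ = edgeVal ends c Λ₀ e
          lower = 0# - η * ((two * two) * C₀)
          Δcharge = 1# * ((two * two - 1#) * w₀ e) - 1# * ((1# * 1# - 1#) * w₀ e)
          rate≡1 : rate e ≡ 1#
          rate≡1 = ≡.cong (λ b → if b then 1# else δ/6) (dec-true (φ (end₁ e) ≟ φ (end₂ e)) (≡.trans φ₁≡γ (≡.sym φ₂≡γ)))
          U₀-nonneg : 0# ≤ U₀
          U₀-nonneg = bilinear-nonneg (u-nonneg e) (values-nonneg N _) (values-nonneg N _)
          lower≤ : lower ≤ objective Λ₁ e
          lower≤ = +-mono-≤ (bilinear-nonneg (u-nonneg e) (values-nonneg M₁ _) (values-nonneg M₁ _))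
                    (-‿antimono-≤ (*-monoˡ-≤-nonneg η η-nonneg
                      (bilinear-≤-scaled two two (c-nonneg e) (values-nonneg M₁ _) (values-nonneg M₁ _)
                                         (Λ₁-γ _ φ₁≡γ) (Λ₁-γ _ φ₂≡γ))))

        bichromatic-Δcharge : ∀ e → φ (end₁ e) ≢ φ (end₂ e) →
          growth (D′ (end₁ e)) * growth (D′ (end₂ e)) ≈ two * (growth (D (end₁ e)) * growth (D (end₂ e))) →
          charge D′ e - charge D e ≈ δ/6 * ((growth (D (end₁ e)) * growth (D (end₂ e))) * w₀ e)
        bichromatic-Δcharge e φ₁≢φ₂ G′≈2G = begin
          charge D′ e - charge D e                          ≡⟨ ≡.cong₂ _-_ (charge-≡ D′ e rate≡δ/6 ≡.refl ≡.refl)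
                                                                             (charge-≡ D e rate≡δ/6 ≡.refl ≡.refl) ⟩
          δ/6 * ((G′ - 1#) * w₀ e) - δ/6 * ((G - 1#) * w₀ e)       ≈⟨ +-congʳ (*-congˡ (*-congʳ (+-congʳ G′≈2G))) ⟩
          δ/6 * ((two * G - 1#) * w₀ e) - δ/6 * ((G - 1#) * w₀ e)  ≈⟨ solve 3 (λ d G w → d :* ((con (+ 2) :* G :- con (+ 1)) :* w)
                                                                       :- d :* ((G :- con (+ 1)) :* w) := d :* (G :* w)) refl δ/6 G (w₀ e) ⟩
          δ/6 * (G * w₀ e)                                  ∎
          where
          open ≈-Reasoning setoid
          G G′ : Carrier
          G  = growth (D (end₁ e)) * growth (D (end₂ e))
          G′ = growth (D′ (end₁ e)) * growth (D′ (end₂ e))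
          rate≡δ/6 : rate e ≡ δ/6
          rate≡δ/6 = ≡.cong (λ b → if b then 1# else δ/6) (dec-false (φ (end₁ e) ≟ φ (end₂ e)) φ₁≢φ₂)

        -- On a bichromatic edge of a node v of colour γ only v moves, and its labels are still the
        -- original ones; rounding v doubles the growth factor of the edge, and the released charge
        -- is exactly δ/6 times the bound on its current weight.
        T-bichromatic : ∀ v e → φ v ≡ γ → Eb v e ≡ true → Δobjective e + δ/6 * weight Λ e ≤ T e
        T-bichromatic v e φv≡γ Eb≡true = +-monoʳ-≤ (Δobjective e)
          (≤-respʳ-≈ (sym (bichromatic-Δcharge e φ₁≢φ₂ (growth-doubles (proj₁ (Eb⇒ Eb≡true)))))
            (*-monoˡ-≤-nonneg δ/6 δ/6-nonneg (weight-≤-scaled Λ Λ₀ e _ _ (values-nonneg M) (M-bound _) (M-bound _))))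
          where
          φ₁≢φ₂ : φ (end₁ e) ≢ φ (end₂ e)
          φ₁≢φ₂ = proj₂ (Eb⇒ Eb≡true)
          growth-doubles : v EndpointOf e →
            growth (D′ (end₁ e)) * growth (D′ (end₂ e)) ≈ two * (growth (D (end₁ e)) * growth (D (end₂ e)))
          growth-doubles (inj₁ ≡.refl) rewrite D′-γ _ φv≡γ | D-γ _ φv≡γ
                                             | D′-other (end₂ e) (λ φ₂≡γ → φ₁≢φ₂ (≡.trans φv≡γ (≡.sym φ₂≡γ))) =
            *-congˡ (sym (*-identityˡ _))
          growth-doubles (inj₂ ≡.refl) rewrite D′-γ _ φv≡γ | D-γ _ φv≡γ
                                             | D′-other (end₁ e) (λ φ₁≡γ → φ₁≢φ₂ (≡.trans φ₁≡γ (≡.sym φv≡γ))) =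
            trans (*-comm _ _) (*-congˡ (sym (*-identityʳ _)))

        T-node : ∀ v → φ v ≡ γ → 0# ≤ sumF (λ e → ind (Eb v e) (T e))
        T-node v φv≡γ = ≤-trans (≤-respʳ-≈ (sym split) (rounding-gain M v (M₁ v) (active v φv≡γ)))
                                (sumF-mono-≤ {m} λ e → ind-mono-≤ (Eb v e) (T-bichromatic v e φv≡γ))
          where
          unchanged : ∀ e → Eb v e ≡ true → ∀ w → w ≢ v → w EndpointOf e → ∀ β → Λ₁ w β ≈ Λ w β
          unchanged e Eb≡true w w≢v w∈e = Λ₁-other w λ φw≡γ →
            bichromatic-other-colour (proj₁ (Eb⇒ Eb≡true)) w∈e w≢v (proj₂ (Eb⇒ Eb≡true)) (≡.trans φw≡γ (≡.sym φv≡γ))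
          split : sumF (λ e → ind (Eb v e) (Δobjective e + δ/6 * weight Λ e))
                  ≈ sumF (λ α → (Λ₁ v α - Λ v α) * phiVal M v α) + δ/6 * sumF (λ α → Λ v α * thetaVal M v α)
          split = trans (sumF-cong {m} λ e → trans (ind-distrib-+ (Eb v e) _ _) (+-congˡ (ind-*ˡ (Eb v e) δ/6 _)))
            (trans (sumF-distrib-+ {m} _ _) (+-cong (bichromatic-objective-change M M₁ v unchanged)
                                                    (trans (*-distribˡ-sumF {m} δ/6 _) (*-congˡ (bichromatic-weight M v)))))

        phase-potential : value M + potential D ≤ value M₁ + potential D′
        phase-potential = begin
          value M + potential D                                         ≈⟨ +-identityˡ _ ⟨
          0# + (value M + potential D)                                  ≤⟨ +-monoˡ-≤ _ 0≤ΣT ⟩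
          ((value M₁ - value M) + (potential D′ - potential D)) + (value M + potential D)
                                                                        ≈⟨ solve 4 (λ a b c d → (a :- b :+ (c :- d)) :+ (b :+ d) := a :+ c)
                                                                                   refl (value M₁) (value M) (potential D′) (potential D) ⟩
          value M₁ + potential D′                                       ∎
          where
          open ≤-Reasoning
          0≤ΣT : 0# ≤ (value M₁ - value M) + (potential D′ - potential D)
          0≤ΣT = ≤-respʳ-≈ (trans (sym (phase-split γ T T-neither))
                                  (trans (sumF-distrib-+ {m} _ _) (+-cong (sumF-distrib-sub {m} _ _) (sumF-distrib-sub {m} _ _))))
            (+-nonneg (sumF-nonneg {m} λ e → ind-nonneg (does (φ (end₁ e) ≟ γ) ∧ does (φ (end₂ e) ≟ γ)) λ both →
                         T-both e (does-≟⇒≡ (proj₁ (∧≡true⇒ both))) (does-≟⇒≡ (proj₂ (∧≡true⇒ both))))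
                      (sumF-nonneg {n} λ v → ind-nonneg (does (φ v ≟ γ)) (T-node v ∘ does-≟⇒≡)))

      processed : List (Fin p) → Fin n → Bool
      processed γs v = not (does (φ v ∈? γs))

      processed≡false⇒∈ : ∀ {γs v} → processed γs v ≡ false → φ v ∈ γs
      processed≡false⇒∈ {γs} {v} _ with φ v ∈? γs
      ... | yes φv∈γs = φv∈γs

      processed≡true⇒∉ : ∀ {γs v} → processed γs v ≡ true → φ v ∉ γs
      processed≡true⇒∉ {γs} {v} _ with φ v ∈? γs
      ... | no φv∉γs = φv∉γs

      ∈⇒processed≡false : ∀ {γs v} → φ v ∈ γs → processed γs v ≡ false
      ∈⇒processed≡false {γs} {v} φv∈γs = ≡.cong not (dec-true (φ v ∈? γs) φv∈γs)

      ∉⇒processed≡true : ∀ {γs v} → φ v ∉ γs → processed γs v ≡ true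
      ∉⇒processed≡true {γs} {v} φv∉γs = ≡.cong not (dec-false (φ v ∈? γs) φv∉γs)

      values-≤-growth : ∀ M v α b → (b ≡ false → M v α ≡ N v α) → (b ≡ true → M v α ℕ.≤ 2 ℕ.* N v α) →
                        values κ M v α ≤ growth b * Λ₀ v α
      values-≤-growth M v α false M≡N _ =
        ≤-reflexive (trans (reflexive (≡.cong (λ k → κ * fromℕ k) (M≡N ≡.refl))) (sym (*-identityˡ _)))
      values-≤-growth M v α true _ M≤2N = values-≤-double {x = N v α} (M≤2N ≡.refl)

      run-potential : ∀ {γs M M′} → Run γs M M′ → Unique γs →
                      (∀ v → φ v ∈ γs → ∀ α → M v α ≡ N v α) → (∀ v → φ v ∉ γs → ∀ α → M v α ℕ.≤ 2 ℕ.* N v α) →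
                      value M + potential (processed γs) ≤ value M′ + potential (λ _ → true)
      run-potential done _ _ _ = ≤-refl
      run-potential {γ ∷ γs} {M} (step {N₁ = M₁} phase run) (γ∉γs ∷ unique) M≡N M≤2N =
        ≤-trans (phase-potential γ M M₁ phase (processed (γ ∷ γs)) (processed γs)
                   (λ v → ∈⇒processed≡false {γ ∷ γs} ∘ here)
                   (λ v φv≡γ → ∉⇒processed≡true {γs} λ φv∈γs → All.lookup γ∉γs φv∈γs (≡.sym φv≡γ))
                   (λ v φv≢γ → processed-other v φv≢γ)
                   (λ v → M≡N v ∘ here)
                   (λ v α → values-≤-growth M v α _ (λ p≡f → M≡N v (processed≡false⇒∈ p≡f) α)
                                                   (λ p≡t → M≤2N v (processed≡true⇒∉ p≡t) α)))
                (run-potential run unique M₁≡N M₁≤2N)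
        where
        open Phase phase
        processed-other : ∀ v → φ v ≢ γ → processed γs v ≡ processed (γ ∷ γs) v
        processed-other v φv≢γ = by-cases (φ v ∈? γs)
          where
          by-cases : Dec (φ v ∈ γs) → processed γs v ≡ processed (γ ∷ γs) v
          by-cases (yes φv∈γs) = ≡.trans (∈⇒processed≡false φv∈γs) (≡.sym (∈⇒processed≡false {γ ∷ γs} (there φv∈γs)))
          by-cases (no  φv∉γs) = ≡.trans (∉⇒processed≡true φv∉γs)
            (≡.sym (∉⇒processed≡true {γ ∷ γs} λ { (here φv≡γ) → φv≢γ φv≡γ ; (there φv∈γs) → φv∉γs φv∈γs }))
        M₁≡N : ∀ v → φ v ∈ γs → ∀ α → M₁ v α ≡ N v α
        M₁≡N v φv∈γs α = ≡.trans (inactive v (λ φv≡γ → All.lookup γ∉γs φv∈γs (≡.sym φv≡γ)) α) (M≡N v (there φv∈γs) α)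
        M₁≤2N : ∀ v → φ v ∉ γs → ∀ α → M₁ v α ℕ.≤ 2 ℕ.* N v α
        M₁≤2N v φv∉γs α with φ v ≟ γ
        ... | yes φv≡γ = ≡.subst (λ k → M₁ v α ℕ.≤ 2 ℕ.* k) (M≡N v (here φv≡γ) α)
                           (RowStep-≤-double (newRow α) (odd⇒1≤ (M v α)))
          where open NodeUpdate (active v φv≡γ)
        ... | no  φv≢γ = ≡.subst (ℕ._≤ 2 ℕ.* N v α) (≡.sym (inactive v φv≢γ α))
                           (M≤2N v (λ { (here φv≡γ) → φv≢γ φv≡γ ; (there φv∈γs) → φv∉γs φv∈γs }) α)

      monochromatic-weight : Carrier
      monochromatic-weight = sumF (λ e → ind (monochromatic e) (w₀ e))

      total-weight : Carrier
      total-weight = sumF w₀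

      -- The defect condition sums over vertices, which counts every edge twice.
      monochromatic-weight-≤ : WADefective ends δ/6 w₀ φ → monochromatic-weight ≤ δ/6 * total-weight
      monochromatic-weight-≤ defective =
        ≤-respˡ-≈ (half-of-double _) (≤-respʳ-≈ (trans (*-congˡ (*-leftComm δ/6 two _)) (half-of-double _))
          (*-monoˡ-≤-nonneg half half-nonneg (≤-respˡ-≈ lhs≈ (≤-respʳ-≈ (*-congˡ rhs≈) defective))))
        where
        half : Carrier
        half = three * sixth
        half-nonneg : 0# ≤ half
        half-nonneg = *-nonneg three-nonneg sixth-nonneg
        half-of-double : ∀ x → half * (two * x) ≈ x
        half-of-double x =
          trans (solve 2 (λ s x → (con (+ 3) :* s) :* (con (+ 2) :* x) := (s :* con (+ 6)) :* x) refl sixth x)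
                (trans (*-congʳ (trans (*-congˡ (sym (fromℕ≈ι 6))) sixth*6≈1)) (*-identityˡ x))
        per-edge : ∀ e → sumF (λ v → ind (incident ends e v ∧ monochromatic e) (w₀ e)) ≈ two * ind (monochromatic e) (w₀ e)
        per-edge e = trans (sumF-cong {n} λ v → ind-∧ (incident ends e v) (monochromatic e) (w₀ e))
          (trans (sym (ind-sumF {n} (monochromatic e) λ v → ind (incident ends e v) (w₀ e)))
          (trans (ind-cong (monochromatic e) (sumF-incident e (w₀ e))) (ind-*ˡ (monochromatic e) two (w₀ e))))
        lhs≈ : sumF (λ v → sumF (λ e → ind (incident ends e v ∧ monochromatic e) (w₀ e))) ≈ two * monochromatic-weight
        lhs≈ = trans (sumF-comm {n} {m} _) (trans (sumF-cong {m} per-edge) (*-distribˡ-sumF {m} two _))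
        rhs≈ : sumF (λ v → sumF (λ e → ind (incident ends e v) (w₀ e))) ≈ two * total-weight
        rhs≈ = trans (sumF-comm {n} {m} _) (trans (sumF-cong {m} λ e → sumF-incident e (w₀ e)) (*-distribˡ-sumF {m} two _))

      potential-initial : potential (processed (allFin p)) ≈ 0#
      potential-initial = sumF-zero {m} λ e →
        trans (reflexive (charge-≡ (processed (allFin p)) e ≡.refl (unprocessed (end₁ e)) (unprocessed (end₂ e))))
              (solve 2 (λ r w → r :* ((con (+ 1) :* con (+ 1) :- con (+ 1)) :* w) := con (+ 0)) refl (rate e) (w₀ e))
        where
        unprocessed : ∀ v → growth (processed (allFin p) v) ≡ 1#
        unprocessed v = ≡.cong growth (∈⇒processed≡false {allFin p} (∈-allFin (φ v)))

      potential-final : WADefective ends δ/6 w₀ φ → potential (λ _ → true) ≤ δ * total-weight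
      potential-final defective = begin
        potential (λ _ → true)                                    ≈⟨ sumF-cong {m} (λ e → solve 2 (λ r w →
                                                                       r :* ((con (+ 2) :* con (+ 2) :- con (+ 1)) :* w)
                                                                       := con (+ 3) :* (r :* w)) refl (rate e) (w₀ e)) ⟩
        sumF (λ e → three * (rate e * w₀ e))                      ≈⟨ *-distribˡ-sumF {m} three _ ⟩
        three * sumF (λ e → rate e * w₀ e)                        ≤⟨ *-monoˡ-≤-nonneg three three-nonneg rate-weight≤ ⟩
        three * (monochromatic-weight + δ/6 * total-weight)      ≤⟨ *-monoˡ-≤-nonneg three three-nonneg
                                                                       (+-monoˡ-≤ _ (monochromatic-weight-≤ defective)) ⟩
        three * (δ/6 * total-weight + δ/6 * total-weight)        ≈⟨ solve 3 (λ d s W → con (+ 3) :* (d :* s :* W :+ d :* s :* W)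
                                                                       := d :* (s :* con (+ 6)) :* W) refl δ sixth total-weight ⟩
        δ * (sixth * ι 6) * total-weight                          ≈⟨ *-congʳ (trans (*-congˡ (trans (*-congˡ (sym (fromℕ≈ι 6))) sixth*6≈1))
                                                                                     (*-identityʳ δ)) ⟩
        δ * total-weight                                          ∎
        where
        open ≤-Reasoning
        w₀-nonneg : ∀ e → 0# ≤ w₀ e
        w₀-nonneg = weight-nonneg Λ₀ (values-nonneg N)
        rate-weight-≤ : ∀ b {w} → 0# ≤ w → (if b then 1# else δ/6) * w ≤ ind b w + δ/6 * w
        rate-weight-≤ true  0≤w = ≤-respˡ-≈ (trans (+-identityʳ _) (sym (*-identityˡ _))) (+-monoʳ-≤ _ (*-nonneg δ/6-nonneg 0≤w))
        rate-weight-≤ false 0≤w = ≤-reflexive (sym (+-identityˡ _))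
        rate-weight≤ : sumF (λ e → rate e * w₀ e) ≤ monochromatic-weight + δ/6 * total-weight
        rate-weight≤ = ≤-respʳ-≈ (trans (sumF-distrib-+ {m} _ _) (+-congˡ (*-distribˡ-sumF {m} δ/6 _)))
          (sumF-mono-≤ {m} λ e → rate-weight-≤ (monochromatic e) (w₀-nonneg e))

      value-≈ : ∀ M → value M ≈ totVal ends u (values κ M) - η * totVal ends c (values κ M)
      value-≈ M = trans (sumF-distrib-sub {m} _ _) (+-congˡ (-‿cong (*-distribˡ-sumF {m} η _)))

      total-weight-≈ : total-weight ≈ totVal ends u Λ₀ + η * totVal ends c Λ₀
      total-weight-≈ = trans (sumF-distrib-+ {m} _ _) (+-congˡ (*-distribˡ-sumF {m} η _))

      rounding-loss : ∀ {N′} → Run (allFin p) N N′ → WADefective ends δ/6 w₀ φ →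
                      value N - δ * total-weight ≤ value N′
      rounding-loss {N′} run defective = begin
        value N - δ * total-weight                                    ≈⟨ +-congʳ (+-identityʳ _) ⟨
        value N + 0# - δ * total-weight                               ≈⟨ +-congʳ (+-congˡ potential-initial) ⟨
        value N + potential (processed (allFin p)) - δ * total-weight
                                                                      ≤⟨ +-monoˡ-≤ _ (run-potential run (allFin⁺ p)
                                                                           (λ _ _ _ → ≡.refl) (λ v φv∉ → contradiction (∈-allFin (φ v)) φv∉)) ⟩
        value N′ + potential (λ _ → true) - δ * total-weight          ≤⟨ +-monoˡ-≤ _ (+-monoʳ-≤ _ (potential-final defective)) ⟩
        value N′ + δ * total-weight - δ * total-weight                ≈⟨ solve 2 (λ x y → x :+ y :- y := x) refl (value N′) (δ * total-weight) ⟩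
        value N′                                                      ∎
        where open ≤-Reasoning

open import Data.Nat using (_*_; _≤_)

lemma2p1 : ∀ {a ℓ₁ ℓ₂ : Level} (F : OrderedField a ℓ₁ ℓ₂) →
    let open Rounding F in
    (n m s : ℕ) (ends : Fin m → Fin n × Fin n) →
    (∀ e → proj₁ (ends e) ≢ proj₂ (ends e)) →
    (u c : Fin m → Fin s → Fin s → Carrier) →
    (∀ e α β → 0# ≤F u e α β) → (∀ e α β → 0# ≤F c e α β) →
    (K : ℕ) → 1 ≤ K → (κ : Carrier) → κ · fromℕ (2 * K) ≈ 1# →
    (N : NumAssign n s) → (∀ v → sumℕ (N v) ≡ 2 * K) →
    (δ η sixth : Carrier) → 0# ≤F δ → δ ≤F 1# → 1# ≤F η →
    sixth · fromℕ 6 ≈ 1# →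
    (p : ℕ) (φ : Fin n → Fin p) →
    WADefective ends (δ · sixth)
      (λ e → edgeVal ends u (values κ N) e + η · edgeVal ends c (values κ N) e) φ →
    (N' : NumAssign n s) →
    Step.Run ends u c κ δ η sixth φ (allFin p) N N' →
    ((∀ v → sumℕ (N' v) ≡ 2 * K) × (∀ v α → Even (N' v α)))
    × ((totVal ends u (values κ N) - η · totVal ends c (values κ N))
         - δ · (totVal ends u (values κ N) + η · totVal ends c (values κ N))
       ≤F (totVal ends u (values κ N') - η · totVal ends c (values κ N')))
lemma2p1 F n m s ends loopless u c u-nonneg c-nonneg K _ κ κ*2K≈1 N N-sums δ η sixth δ-nonneg _ 1≤η sixth*6≈1
         p φ defective N′ run =
  ((λ v → ≡.trans (proj₂ (rows v)) (N-sums v)) , (λ v → proj₁ (rows v))) ,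
  ≤-respˡ-≈ (+-cong (value-≈ N) (-‿cong (*-congˡ total-weight-≈))) (≤-respʳ-≈ (value-≈ N′) (rounding-loss run defective))
  where
  open OrderedFieldProperties F renaming (_*_ to _·_; _≤_ to _≤F_)
  κ-nonneg : 0# ≤F κ
  κ-nonneg = 0≤x*y≈1⇒0≤x (fromℕ-nonneg (2 * K)) κ*2K≈1
  open BasicRoundingStep F ends loopless u c u-nonneg c-nonneg κ κ-nonneg δ η sixth δ-nonneg (≤-trans 0≤1 1≤η) sixth*6≈1 φ
  open Potential N
  rows : ∀ v → (∀ α → Even (N′ v α)) × sumℕ (N′ v) ≡ sumℕ (N v)
  rows v = proj₂ (run-rows run (allFin⁺ p) v) (∈-allFin (φ v))
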